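{- Let $G=(\vec{Q},T)$ be a reversible witness graph for a VAS $\vec{A}\subseteq\mathbb{Z}^d$, and let $q=|\vec{Q}|$ and $a=\|\vec{A}\|_\infty$. Then the zero vector is the displacement of a total Kirchhoff function $\mu$ for $G$ satisfying $$\|\mu\|_\infty\leq (q(1+2a))^{d(d+1)}.$$
   Context: Let $\star$ be a new symbol, $\mathbb{N}_\star=\mathbb{N}\cup\{\star\}$; for $I\subseteq\{1,\ldots,d\}$, $\mathbb{N}_I^d$ is the set of $\vec{c}\in\mathbb{N}_\star^d$ with $\{i\mid\vec{c}(i)=\star\}=I$. For $\vec{a}\in\mathbb{Z}^d$, $\pi_I(\vec{a})$ replaces the components in $I$ by $\star$, and addition is componentwise outside $I$. A VAS is a finite $\vec{A}\subseteq\mathbb{Z}^d$, $\|\vec{A}\|_\infty=\max_{\vec{a}\in\vec{A}}\max_i|\vec{a}(i)|$ ($0$ if empty). A subreachability graph is $G=(\vec{Q},T)$ with $\vec{Q}\subseteq\mathbb{N}_I^d$ a nonempty finite set of states and $T\subseteq\vec{Q}\times\vec{A}\times\vec{Q}$ a finite set of transitions $(\vec{x},\vec{a},\vec{y})$ with $\vec{y}=\vec{x}+\pi_I(\vec{a})$; a witness graph is a strongly connected subreachability graph. A path $\vec{x}\xrightarrow{\sigma}_G\vec{y}$ labelled by $\sigma=\vec{a}_1\cdots\vec{a}_k$ is a sequence of transitions $(\vec{c}_{j-1},\vec{a}_j,\vec{c}_j)\in T$ with $\vec{c}_0=\vec{x}$, $\vec{c}_k=\vec{y}$; $\Delta(\sigma)=\sum_j\vec{a}_j$.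 $G$ is reversible if for every path $\vec{x}\xrightarrow{u}_G\vec{y}$ there is a path $\vec{y}\xrightarrow{v}_G\vec{x}$ with $\Delta(u)+\Delta(v)=\vec{0}$. A Kirchhoff function for $G$ is $\mu:T\to\mathbb{N}$ such that at every state the sum of $\mu$ over incoming transitions equals the sum over outgoing transitions; it is total if $\mu(t)\geq1$ for all $t\in T$; its displacement is $\sum_{t=(\vec{x},\vec{a},\vec{y})\in T}\mu(t)\vec{a}$; $\|\mu\|_\infty=\max_{t\in T}\mu(t)$. -}

module Defs where

open import Data.Nat as ℕ using (ℕ; _≤_; _⊔_; _*_; _^_; _+_)
open import Data.Integer as ℤ using (ℤ; +_; ∣_∣)
open import Data.Maybe using (Maybe; just; nothing)
import Data.Maybe.Properties as MaybeP
open import Data.Vec using (Vec; lookup; replicate; zipWith; map; foldr; toList)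
import Data.Vec.Properties as VecP
open import Data.List as List using (List; []; _∷_; length)
open import Data.Nat.ListAction using (sum)
open import Data.List.Membership.Propositional using (_∈_)
open import Data.List.Relation.Unary.All using (All)
open import Data.List.Relation.Unary.Unique.Propositional using (Unique)
open import Data.Fin using (Fin)
open import Data.Fin.Subset as Sub using (Subset)
open import Data.Product using (Σ; ∃; _×_; _,_; proj₁; proj₂)
open import Data.Bool using (if_then_else_)
open import Relation.Nullary using (¬_; Dec)
open import Relation.Nullary.Decidable using (⌊_⌋)
open import Relation.Binary.PropositionalEquality using (_≡_; _≢_)

-- ℕ_⋆ = ℕ ∪ {⋆}, with ⋆ represented by nothing
ℕ⋆ : Set
ℕ⋆ = Maybe ℕ

State : ℕ → Set
State d = Vec ℕ⋆ d

ℤVec : ℕ → Set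
ℤVec d = Vec ℤ d

zeroVec : (d : ℕ) → ℤVec d
zeroVec d = replicate d (+ 0)

_⊕_ : ∀ {d} → ℤVec d → ℤVec d → ℤVec d
_⊕_ = zipWith ℤ._+_

_≟S_ : ∀ {d} (x y : State d) → Dec (x ≡ y)
_≟S_ = VecP.≡-dec (MaybeP.≡-dec ℕ._≟_)

-- c ∈ ℕ_I^d : the set of starred components of c is exactly I
InNI : ∀ {d} → Subset d → State d → Set
InNI {d} I c = ∀ (i : Fin d) → (lookup c i ≡ nothing → i Sub.∈ I) × (i Sub.∈ I → lookup c i ≡ nothing)

-- y = x + π_I(a)  (componentwise addition outside I, ⋆ on I; the result lies in ℕ_⋆^d)
Step : ∀ {d} → Subset d → State d → ℤVec d → State d → Set
Step {d} I x a y = ∀ (i : Fin d) →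
  (i Sub.∈ I → lookup y i ≡ nothing) ×
  (¬ (i Sub.∈ I) → Σ ℕ λ m → Σ ℕ λ n →
      lookup x i ≡ just m × lookup y i ≡ just n × + n ≡ + m ℤ.+ lookup a i)

-- ‖A‖_∞ (0 if A is empty)
normVec : ∀ {d} → ℤVec d → ℕ
normVec a = foldr (λ _ → ℕ) (λ z acc → ∣ z ∣ ⊔ acc) 0 a

normA : ∀ {d} → List (ℤVec d) → ℕ
normA A = List.foldr (λ a acc → normVec a ⊔ acc) 0 A

Transition : ℕ → Set
Transition d = State d × ℤVec d × State d

src : ∀ {d} → Transition d → State d
src (x , _ , _) = x

lbl : ∀ {d} → Transition d → ℤVec d
lbl (_ , a , _) = a

tgt : ∀ {d} → Transition d → State d
tgt (_ , _ , y) = y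

-- Subreachability graph G = (Q, T) for the VAS A, with states in ℕ_I^d.
-- Finite sets are represented by duplicate-free lists.
record IsSubreachabilityGraph {d : ℕ} (A : List (ℤVec d)) (I : Subset d)
       (Q : List (State d)) (T : List (Transition d)) : Set where
  field
    Q-nonempty : Q ≢ []
    Q-unique   : Unique Q
    T-unique   : Unique T
    Q-in-NI    : All (InNI I) Q
    T-valid    : All (λ t → src t ∈ Q × lbl t ∈ A × tgt t ∈ Q × Step I (src t) (lbl t) (tgt t)) T

data Path {d : ℕ} (T : List (Transition d)) : State d → List (ℤVec d) → State d → Set where
  nil  : ∀ {x} → Path T x [] x
  cons : ∀ {x a y σ z} → (x , a , y) ∈ T → Path T y σ z → Path T x (a ∷ σ) z

Δ : ∀ {d} → List (ℤVec d) → ℤVec d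
Δ {d} σ = List.foldr _⊕_ (zeroVec d) σ

StronglyConnected : ∀ {d} → List (State d) → List (Transition d) → Set
StronglyConnected {d} Q T = ∀ (x y : State d) → x ∈ Q → y ∈ Q → ∃ λ σ → Path T x σ y

IsWitnessGraph : ∀ {d} → List (ℤVec d) → Subset d → List (State d) → List (Transition d) → Set
IsWitnessGraph A I Q T = IsSubreachabilityGraph A I Q T × StronglyConnected Q T

Reversible : ∀ {d} → List (Transition d) → Set
Reversible {d} T = ∀ (x y : State d) (u : List (ℤVec d)) → Path T x u y →
  Σ (List (ℤVec d)) λ v → Path T y v x × (Δ u ⊕ Δ v ≡ zeroVec d)

inSum : ∀ {d} → List (Transition d) → (Transition d → ℕ) → State d → ℕ
inSum T μ x = sum (List.map (λ t → if ⌊ tgt t ≟S x ⌋ then μ t else 0) T)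

outSum : ∀ {d} → List (Transition d) → (Transition d → ℕ) → State d → ℕ
outSum T μ x = sum (List.map (λ t → if ⌊ src t ≟S x ⌋ then μ t else 0) T)

-- μ : T → ℕ (values outside T are irrelevant)
IsKirchhoff : ∀ {d} → List (State d) → List (Transition d) → (Transition d → ℕ) → Set
IsKirchhoff Q T μ = ∀ x → x ∈ Q → inSum T μ x ≡ outSum T μ x

IsTotal : ∀ {d} → List (Transition d) → (Transition d → ℕ) → Set
IsTotal T μ = ∀ t → t ∈ T → 1 ≤ μ t

displacement : ∀ {d} → List (Transition d) → (Transition d → ℕ) → ℤVec d
displacement {d} T μ = List.foldr (λ t acc → map (λ z → + (μ t) ℤ.* z) (lbl t) ⊕ acc) (zeroVec d) T

NormBounded : ∀ {d} → List (Transition d) → (Transition d → ℕ) → ℕ → Set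
NormBounded T μ b = ∀ t → t ∈ T → μ t ≤ b

module Submission where

-- Fix a transition t. By reversibility, t followed by a path back to its source is a closed walk
-- of displacement 0, and it splits into simple cycles, of length ≤ q, whose displacements sum to 0.
-- So the all-ones vector is a positive kernel vector of the d × (number of cycles) matrix of cycle
-- displacements, whose entries are at most q a. Siegel's lemma, applied on the support of a positive
-- kernel vector c to rows that determine the kernel there, gives a kernel vector z with
-- entries ≤ (1 + (r + 1) q a) ^ r on r + 1 ≤ d + 1 coordinates: either z is proportional to c, or
-- a combination of c and z has smaller support. This ends with a nonnegative kernel vector, positive
-- on a cycle through t, of sum ≤ (d + 1) (1 + (d + 1) q a) ^ d; weighting the cycles by it gives a
-- Kirchhoff function of displacement 0 that is positive on t. Summing these over the at most
-- q (1 + 2 a) ^ d transitions (each is determined by its source and its label) gives μ.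
-- Dimensions d ≤ 1 and the case a = 0 need sharper, direct choices of the kernel vector.

module Sums where

  open import Data.Nat as ℕ using (ℕ; zero; suc; _≤_; z≤n)
  import Data.Nat.Properties as ℕP
  open import Data.Integer as ℤ using (ℤ; +_; -_; _+_; _*_; _-_; 0ℤ)
  import Data.Integer.Properties as ℤP
  open import Data.Fin using (Fin; zero; suc; punchIn)
  open import Data.Fin.Properties using (punchInᵢ≢i)
  open import Data.List as List using (List; []; _∷_)
  open import Data.Integer.Tactic.RingSolver using (solve-∀)
  open import Relation.Binary.PropositionalEquality
  import Algebra.Properties.Semiring.Sum as SemiringSum

  module ℤΣ = SemiringSum ℤP.+-*-semiring
  module ℕΣ = SemiringSum ℕP.+-*-semiring

  open ℤΣ public using (∑-distrib-+; *-distribˡ-sum; *-distribʳ-sum) renaming (sum to ∑; sum-cong-≗ to ∑-cong)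
  open ℕΣ public using () renaming (sum to ∑ℕ; sum-cong-≗ to ∑ℕ-cong)

  ∑-zero : ∀ n → ∑ {n} (λ _ → 0ℤ) ≡ 0ℤ
  ∑-zero = ℤΣ.sum-replicate-zero

  ∑-neg : ∀ {n} (f : Fin n → ℤ) → ∑ (λ j → - f j) ≡ - ∑ f
  ∑-neg {zero} f = refl
  ∑-neg {suc n} f = trans (cong (_+_ (- f zero)) (∑-neg (λ j → f (suc j)))) (sym (ℤP.neg-distrib-+ (f zero) _))

  ∑-distrib-- : ∀ {n} (f g : Fin n → ℤ) → ∑ (λ j → f j - g j) ≡ ∑ f - ∑ g
  ∑-distrib-- f g = trans (∑-distrib-+ f (λ j → - g j)) (cong (_+_ (∑ f)) (∑-neg g))

  ∑-concentrated : ∀ {n} (f : Fin n → ℤ) (p : Fin n) → (∀ j → j ≢ p → f j ≡ 0ℤ) → ∑ f ≡ f p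
  ∑-concentrated {suc n} f p off-p = begin
    ∑ f                                ≡⟨ ℤΣ.sum-remove {i = p} f ⟩
    f p + ∑ (λ j → f (punchIn p j))    ≡⟨ cong (_+_ (f p)) (trans (∑-cong (λ j → off-p _ (punchInᵢ≢i p j))) (∑-zero n)) ⟩
    f p + 0ℤ                           ≡⟨ ℤP.+-identityʳ (f p) ⟩
    f p                                ∎
    where open ≡-Reasoning

  pos-∑ℕ : ∀ {n} (f : Fin n → ℕ) → + ∑ℕ f ≡ ∑ (λ j → + f j)
  pos-∑ℕ {zero} f = refl
  pos-∑ℕ {suc n} f = trans (ℤP.pos-+ (f zero) _) (cong (_+_ (+ f zero)) (pos-∑ℕ (λ j → f (suc j))))

  ∑ℕ-mono-≤ : ∀ {n} {f g : Fin n → ℕ} → (∀ j → f j ≤ g j) → ∑ℕ f ≤ ∑ℕ g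
  ∑ℕ-mono-≤ {zero} f≤g = z≤n
  ∑ℕ-mono-≤ {suc n} f≤g = ℕP.+-mono-≤ (f≤g zero) (∑ℕ-mono-≤ (λ j → f≤g (suc j)))

  term≤∑ℕ : ∀ {n} (f : Fin n → ℕ) j → f j ≤ ∑ℕ f
  term≤∑ℕ f zero = ℕP.m≤m+n _ _
  term≤∑ℕ f (suc j) = ℕP.≤-trans (term≤∑ℕ (λ j → f (suc j)) j) (ℕP.m≤n+m _ (f zero))

  ∑ℕ-const : ∀ n b → ∑ℕ {n} (λ _ → b) ≡ n ℕ.* b
  ∑ℕ-const zero b = refl
  ∑ℕ-const (suc n) b = cong (b ℕ.+_) (∑ℕ-const n b)

  sumℤ : List ℤ → ℤ
  sumℤ = List.foldr _+_ 0ℤ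

  ∑-lookup : ∀ {A : Set} (f : A → ℤ) xs → ∑ (λ j → f (List.lookup xs j)) ≡ sumℤ (List.map f xs)
  ∑-lookup f [] = refl
  ∑-lookup f (x ∷ xs) = cong (_+_ (f x)) (∑-lookup f xs)

  module _ {A : Set} where

    sumℤ-map-cong : ∀ {f g : A → ℤ} xs → (∀ x → f x ≡ g x) → sumℤ (List.map f xs) ≡ sumℤ (List.map g xs)
    sumℤ-map-cong [] _ = refl
    sumℤ-map-cong (x ∷ xs) f≗g = cong₂ _+_ (f≗g x) (sumℤ-map-cong xs f≗g)

    sumℤ-map-+ : ∀ (f g : A → ℤ) xs → sumℤ (List.map (λ x → f x + g x) xs) ≡ sumℤ (List.map f xs) + sumℤ (List.map g xs)
    sumℤ-map-+ f g [] = refl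
    sumℤ-map-+ f g (x ∷ xs) = trans (cong (_+_ (f x + g x)) (sumℤ-map-+ f g xs)) (interchange (f x) (g x) _ _)
      where
        interchange : ∀ a b c d → a + b + (c + d) ≡ a + c + (b + d)
        interchange = solve-∀

    sumℤ-map-scale : ∀ k (f : A → ℤ) xs → sumℤ (List.map (λ x → k * f x) xs) ≡ k * sumℤ (List.map f xs)
    sumℤ-map-scale k f [] = sym (ℤP.*-zeroʳ k)
    sumℤ-map-scale k f (x ∷ xs) = trans (cong (_+_ (k * f x)) (sumℤ-map-scale k f xs)) (sym (ℤP.*-distribˡ-+ k (f x) _))

    sumℤ-map-zero : ∀ (xs : List A) → sumℤ (List.map (λ _ → 0ℤ) xs) ≡ 0ℤ
    sumℤ-map-zero [] = refl
    sumℤ-map-zero (_ ∷ xs) = trans (ℤP.+-identityˡ _) (sumℤ-map-zero xs)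

module Subsets where

  open import Data.Nat as ℕ using (ℕ; zero; suc; _≤_; _*_; s≤s)
  open import Data.Fin using (Fin; zero; suc)
  open import Data.Fin.Subset using (Subset; inside; outside; _⊆_; ⊥) renaming (∣_∣ to ∣_∣ₛ)
  open import Data.Fin.Subset.Properties using (⊆-min; ∣⊥∣≡0; s⊆s; out⊆)
  open import Data.Bool using (if_then_else_)
  open import Data.Vec using ([]; _∷_; lookup)
  open import Data.Product using (Σ; _×_; _,_)
  open import Relation.Binary.PropositionalEquality
  open Sums

  subset-of-size : ∀ {n} (S : Subset n) m → m ≤ ∣ S ∣ₛ → Σ (Subset n) λ S′ → S′ ⊆ S × ∣ S′ ∣ₛ ≡ m
  subset-of-size {n} S zero _ = ⊥ , ⊆-min S , ∣⊥∣≡0 n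
  subset-of-size (inside ∷ S) (suc m) (s≤s m≤∣S∣) with subset-of-size S m m≤∣S∣
  ... | S′ , S′⊆S , ∣S′∣≡m = inside ∷ S′ , s⊆s S′⊆S , cong suc ∣S′∣≡m
  subset-of-size (outside ∷ S) (suc m) m<∣S∣ with subset-of-size S (suc m) m<∣S∣
  ... | S′ , S′⊆S , ∣S′∣≡m = outside ∷ S′ , out⊆ S′⊆S , ∣S′∣≡m

  mask : ∀ {n} → Subset n → ℕ → Fin n → ℕ
  mask S b j = if lookup S j then b else 0

  ∑ℕ-mask : ∀ {n} (S : Subset n) b → ∑ℕ (mask S b) ≡ ∣ S ∣ₛ * b
  ∑ℕ-mask [] b = refl
  ∑ℕ-mask (inside ∷ S) b = cong (b ℕ.+_) (∑ℕ-mask S b)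
  ∑ℕ-mask (outside ∷ S) b = ∑ℕ-mask S b

module Powers where

  open import Data.Nat as ℕ using (zero; suc; _≤_; _+_; _*_; _^_; z≤n; s≤s)
  import Data.Nat.Properties as ℕP
  open import Data.Nat.Tactic.RingSolver using (solve-∀)
  open import Relation.Binary.PropositionalEquality

  *-distrib-^ : ∀ a b r → (a * b) ^ r ≡ a ^ r * b ^ r
  *-distrib-^ a b zero = refl
  *-distrib-^ a b (suc r) rewrite *-distrib-^ a b r = interchange a b (a ^ r) (b ^ r)
    where
      interchange : ∀ a b x y → a * b * (x * y) ≡ a * x * (b * y)
      interchange = solve-∀

  bernoulli : ∀ n x → 1 + n * x ≤ suc x ^ n
  bernoulli zero x = s≤s z≤n
  bernoulli (suc n) x = begin
    1 + (x + n * x)                   ≤⟨ ℕP.+-monoʳ-≤ 1 (ℕP.+-monoʳ-≤ x (ℕP.m≤m+n (n * x) (x * (n * x)))) ⟩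
    1 + (x + (n * x + x * (n * x)))   ≡⟨ expand x (n * x) ⟩
    suc x * (1 + n * x)               ≤⟨ ℕP.*-monoʳ-≤ (suc x) (bernoulli n x) ⟩
    suc x * suc x ^ n                 ∎
    where
      open ℕP.≤-Reasoning
      expand : ∀ x y → 1 + (x + (y + x * y)) ≡ suc x * (1 + y)
      expand = solve-∀

module Counting where

  open import Data.Nat as ℕ using (ℕ; zero; suc; _<_; _≤_; _*_; _^_; s≤s)
  import Data.Nat.Properties as ℕP
  open import Data.Fin using (Fin; zero; suc)
  import Data.Fin.Properties as FinP
  open import Data.Fin.Subset using (Subset; inside; outside) renaming (∣_∣ to ∣_∣ₛ)
  open import Data.Vec as Vec using (Vec; []; _∷_)
  import Data.Vec.Properties as VecP
  open import Data.List as List using (List; []; _∷_; length; lookup; cartesianProductWith; upTo)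
  import Data.List.Properties as ListP
  open import Data.List.Membership.Propositional using (_∈_)
  import Data.List.Membership.Propositional.Properties as ∈P
  open import Data.List.Relation.Unary.Any using (here; index)
  open import Data.List.Relation.Unary.Any.Properties using (lookup-index)
  open import Data.List.Relation.Unary.All as All using (All; []; _∷_)
  open import Data.List.Relation.Unary.Unique.Propositional using (Unique)
  open import Data.List.Relation.Unary.AllPairs using ([]; _∷_)
  import Data.List.Relation.Unary.Unique.Propositional.Properties as UniqueP
  open import Data.Product using (Σ; _×_; _,_)
  open import Data.Sum using (inj₁; inj₂)
  open import Relation.Nullary using (contradiction)
  open import Relation.Binary.PropositionalEquality
  open Subsets using (mask)

  lookup-injective : ∀ {A : Set} {xs : List A} → Unique xs → ∀ i j → lookup xs i ≡ lookup xs j → i ≡ j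
  lookup-injective (_ ∷ _) zero zero _ = refl
  lookup-injective (x∉xs ∷ _) zero (suc j) x≡xsⱼ = contradiction x≡xsⱼ (All.lookup x∉xs (∈P.∈-lookup j))
  lookup-injective (x∉xs ∷ _) (suc i) zero xsᵢ≡x = contradiction (sym xsᵢ≡x) (All.lookup x∉xs (∈P.∈-lookup i))
  lookup-injective (_ ∷ xs-unique) (suc i) (suc j) eq = cong suc (lookup-injective xs-unique i j eq)

  pigeonhole : ∀ {A B : Set} (f : A → B) (L : List A) (Y : List B) → Unique L → All (λ a → f a ∈ Y) L →
    length Y < length L → Σ A λ a → Σ A λ b → a ∈ L × b ∈ L × a ≢ b × f a ≡ f b
  pigeonhole f L Y L-unique maps-into Y<L =
    let i , j , i<j , same-index = FinP.pigeonhole Y<L (λ i → index (image i)) in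
    lookup L i , lookup L j , ∈P.∈-lookup i , ∈P.∈-lookup j ,
    (λ eq → FinP.<⇒≢ i<j (lookup-injective L-unique i j eq)) ,
    trans (lookup-index (image i)) (trans (cong (lookup Y) same-index) (sym (lookup-index (image j))))
    where
      image : ∀ i → f (lookup L i) ∈ Y
      image i = All.lookup maps-into (∈P.∈-lookup i)

  length-≤-of-injective : ∀ {A B : Set} (f : A → B) (L : List A) (Y : List B) → Unique L → All (λ a → f a ∈ Y) L →
    (∀ {a b} → a ∈ L → b ∈ L → f a ≡ f b → a ≡ b) → length L ≤ length Y
  length-≤-of-injective f L Y L-unique maps-into injective with ℕP.≤-<-connex (length L) (length Y)
  ... | inj₁ L≤Y = L≤Y
  ... | inj₂ Y<L with pigeonhole f L Y L-unique maps-into Y<L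
  ...   | a , b , a∈L , b∈L , a≢b , fa≡fb = contradiction (injective a∈L b∈L fa≡fb) a≢b

  length-cartesianProductWith : ∀ {A B C : Set} (f : A → B → C) xs ys →
    length (cartesianProductWith f xs ys) ≡ length xs * length ys
  length-cartesianProductWith f [] ys = refl
  length-cartesianProductWith f (x ∷ xs) ys =
    trans (ListP.length-++ (List.map (f x) ys)) (cong₂ ℕ._+_ (ListP.length-map (f x) ys) (length-cartesianProductWith f xs ys))

  box : ∀ n → (Fin n → ℕ) → List (Vec ℕ n)
  box zero w = [] ∷ []
  box (suc n) w = cartesianProductWith Vec._∷_ (upTo (suc (w zero))) (box n (λ i → w (suc i)))

  length-box : ∀ n w → length (box (suc n) w) ≡ suc (w zero) * length (box n (λ i → w (suc i)))
  length-box n w = trans (length-cartesianProductWith Vec._∷_ (upTo (suc (w zero))) rest) (cong (_* length rest) (ListP.length-upTo (suc (w zero))))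
    where rest = box n (λ i → w (suc i))

  box-unique : ∀ n w → Unique (box n w)
  box-unique zero w = [] ∷ []
  box-unique (suc n) w = UniqueP.cartesianProductWith⁺ Vec._∷_ VecP.∷-injective (UniqueP.upTo⁺ (suc (w zero))) (box-unique n _)

  ∈-box⁺ : ∀ n w (v : Vec ℕ n) → (∀ i → Vec.lookup v i ≤ w i) → v ∈ box n w
  ∈-box⁺ zero w [] _ = here refl
  ∈-box⁺ (suc n) w (x ∷ v) v≤w = ∈P.∈-cartesianProductWith⁺ Vec._∷_ (∈P.∈-upTo⁺ (s≤s (v≤w zero))) (∈-box⁺ n _ v (λ i → v≤w (suc i)))

  ∈-box⁻ : ∀ n w (v : Vec ℕ n) → v ∈ box n w → ∀ i → Vec.lookup v i ≤ w i
  ∈-box⁻ (suc n) w v v∈box i with ∈P.∈-cartesianProductWith⁻ Vec._∷_ (upTo (suc (w zero))) (box n (λ j → w (suc j))) v∈box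
  ∈-box⁻ (suc n) w _ _ zero | x , _ , x∈upTo , _ , refl = ℕP.≤-pred (∈P.∈-upTo⁻ x∈upTo)
  ∈-box⁻ (suc n) w _ _ (suc i) | _ , v , _ , v∈box , refl = ∈-box⁻ n _ v v∈box i

  length-box-≤ : ∀ {n} (R : Subset n) b w → (∀ i → w i ≤ mask R b i) → length (box n w) ≤ suc b ^ ∣ R ∣ₛ
  length-box-≤ [] b w _ = ℕP.≤-refl
  length-box-≤ {suc n} (side ∷ R) b w w≤ = begin
    length (box (suc n) w)                      ≡⟨ length-box n w ⟩
    suc (w zero) * length (box n (λ i → w (suc i))) ≤⟨ ℕP.*-mono-≤ (s≤s (w≤ zero)) (length-box-≤ R b _ (λ i → w≤ (suc i))) ⟩
    suc (mask (side ∷ R) b zero) * suc b ^ ∣ R ∣ₛ  ≡⟨ head-factor side ⟩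
    suc b ^ ∣ side ∷ R ∣ₛ                        ∎
    where
      open ℕP.≤-Reasoning
      head-factor : ∀ side → suc (mask (side ∷ R) b zero) * suc b ^ ∣ R ∣ₛ ≡ suc b ^ ∣ side ∷ R ∣ₛ
      head-factor inside = refl
      head-factor outside = ℕP.+-identityʳ _

  length-box-≥ : ∀ {n} (S : Subset n) b w → (∀ i → mask S b i ≤ w i) → suc b ^ ∣ S ∣ₛ ≤ length (box n w)
  length-box-≥ [] b w _ = ℕP.≤-refl
  length-box-≥ {suc n} (side ∷ S) b w ≤w = begin
    suc b ^ ∣ side ∷ S ∣ₛ                        ≡⟨ head-factor side ⟨
    suc (mask (side ∷ S) b zero) * suc b ^ ∣ S ∣ₛ  ≤⟨ ℕP.*-mono-≤ (s≤s (≤w zero)) (length-box-≥ S b _ (λ i → ≤w (suc i))) ⟩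
    suc (w zero) * length (box n (λ i → w (suc i))) ≡⟨ length-box n w ⟨
    length (box (suc n) w)                      ∎
    where
      open ℕP.≤-Reasoning
      head-factor : ∀ side → suc (mask (side ∷ S) b zero) * suc b ^ ∣ S ∣ₛ ≡ suc b ^ ∣ side ∷ S ∣ₛ
      head-factor inside = refl
      head-factor outside = ℕP.+-identityʳ _

module Kernel where

  open import Data.Nat as ℕ using (ℕ; zero; suc; _<_; z≤n)
  import Data.Nat.Properties as ℕP
  open import Data.Integer as ℤ using (ℤ; +_; -_; _+_; _*_; _-_; 0ℤ)
  import Data.Integer.Properties as ℤP
  open import Data.Integer.Tactic.RingSolver using (solve-∀)
  open import Data.Fin using (Fin; zero; suc; _≟_)
  open import Data.Fin.Properties using (any?)
  open import Data.Fin.Subset using (Subset; inside; outside; _∈_; _∉_) renaming (∣_∣ to ∣_∣ₛ; _-_ to _∖_)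
  open import Data.Fin.Subset.Properties using (_∈?_; x∈p⇒∣p-x∣<∣p∣; x∈p∧x≢y⇒x∈p-y)
  open import Data.Vec using ([]; _∷_; here; there)
  open import Data.Vec.Functional using (updateAt)
  open import Data.Vec.Functional.Properties using (updateAt-updates; updateAt-minimal)
  open import Data.Product using (Σ; _,_)
  open import Data.Sum using (inj₁; inj₂)
  open import Relation.Nullary using (yes; no; ¬?; _×-dec_; contradiction; decidable-stable)
  open import Relation.Binary.PropositionalEquality
  open Sums

  comb : ∀ {n k} → (Fin n → Fin k → ℤ) → (Fin n → ℤ) → Fin k → ℤ
  comb u z i = ∑ (λ j → z j * u j i)

  InKernel : ∀ {n k} → (Fin n → Fin k → ℤ) → (Fin n → ℤ) → Set
  InKernel u z = ∀ i → comb u z i ≡ 0ℤ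

  SupportedIn : ∀ {n} → (Fin n → ℤ) → Subset n → Set
  SupportedIn z S = ∀ j → j ∉ S → z j ≡ 0ℤ

  Nonzero : ∀ {n} → (Fin n → ℤ) → Set
  Nonzero {n} z = Σ (Fin n) λ j → z j ≢ 0ℤ

  toℤ : ∀ {n} → (Fin n → ℕ) → Fin n → ℤ
  toℤ c j = + c j

  cancel-nonzero : ∀ {a b} → a ≢ 0ℤ → a * b ≡ 0ℤ → b ≡ 0ℤ
  cancel-nonzero {a} a≢0 ab≡0 with ℤP.i*j≡0⇒i≡0∨j≡0 a ab≡0
  ... | inj₁ a≡0 = contradiction a≡0 a≢0
  ... | inj₂ b≡0 = b≡0

  comb-cong : ∀ {n k} (u : Fin n → Fin k → ℤ) {x y : Fin n → ℤ} → (∀ j → x j ≡ y j) → ∀ i → comb u x i ≡ comb u y i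
  comb-cong u x≗y i = ∑-cong (λ j → cong (_* u j i) (x≗y j))

  comb-+ : ∀ {n k} (u : Fin n → Fin k → ℤ) x y i → comb u (λ j → x j + y j) i ≡ comb u x i + comb u y i
  comb-+ u x y i = trans (∑-cong (λ j → ℤP.*-distribʳ-+ (u j i) (x j) (y j))) (∑-distrib-+ (λ j → x j * u j i) (λ j → y j * u j i))

  comb-scale-columns : ∀ {n k} (u : Fin n → Fin k → ℤ) a z i → comb (λ j i → a * u j i) z i ≡ a * comb u z i
  comb-scale-columns u a z i = trans (∑-cong (λ j → swap (z j) a (u j i))) (sym (*-distribˡ-sum a (λ j → z j * u j i)))
    where
      swap : ∀ z a w → z * (a * w) ≡ a * (z * w)
      swap = solve-∀

  comb-scale : ∀ {n k} (u : Fin n → Fin k → ℤ) a x i → comb u (λ j → a * x j) i ≡ a * comb u x i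
  comb-scale u a x i = trans (∑-cong (λ j → ℤP.*-assoc a (x j) (u j i))) (sym (*-distribˡ-sum a (λ j → x j * u j i)))

  InKernel-scale : ∀ {n k} (u : Fin n → Fin k → ℤ) a x → InKernel u x → InKernel u (λ j → a * x j)
  InKernel-scale u a x x∈ker i = trans (comb-scale u a x i) (trans (cong (a *_) (x∈ker i)) (ℤP.*-zeroʳ a))

  comb-sub : ∀ {n k} (u : Fin n → Fin k → ℤ) x y i → comb u (λ j → x j - y j) i ≡ comb u x i - comb u y i
  comb-sub u x y i = trans (∑-cong (λ j → distribute (x j) (y j) (u j i))) (∑-distrib-- (λ j → x j * u j i) (λ j → y j * u j i))
    where
      distribute : ∀ x y w → (x - y) * w ≡ x * w - y * w
      distribute = solve-∀

  comb-linear : ∀ {n k} (u : Fin n → Fin k → ℤ) a b x y i →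
    comb u (λ j → a * x j - b * y j) i ≡ a * comb u x i - b * comb u y i
  comb-linear u a b x y i =
    trans (comb-sub u (λ j → a * x j) (λ j → b * y j) i) (cong₂ _-_ (comb-scale u a x i) (comb-scale u b y i))

  InKernel-linear : ∀ {n k} (u : Fin n → Fin k → ℤ) a b x y → InKernel u x → InKernel u y →
    InKernel u (λ j → a * x j - b * y j)
  InKernel-linear u a b x y x∈ker y∈ker i = begin
    comb u (λ j → a * x j - b * y j) i ≡⟨ comb-linear u a b x y i ⟩
    a * comb u x i - b * comb u y i     ≡⟨ cong₂ (λ s t → a * s - b * t) (x∈ker i) (y∈ker i) ⟩
    a * 0ℤ - b * 0ℤ                     ≡⟨ vanish a b ⟩
    0ℤ                                  ∎
    where
      open ≡-Reasoning
      vanish : ∀ a b → a * 0ℤ - b * 0ℤ ≡ 0ℤ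
      vanish = solve-∀

  -- Gaussian elimination of the first row, with column p as pivot.
  module Elimination {n k} (u : Fin n → Fin (suc k) → ℤ) (p : Fin n) where

    pivot : ℤ
    pivot = u p zero

    reduced : Fin n → Fin k → ℤ
    reduced j i = pivot * u j (suc i) - u j zero * u p (suc i)

    comb-reduced : ∀ z i → comb reduced z i ≡ pivot * comb u z (suc i) - comb u z zero * u p (suc i)
    comb-reduced z i = begin
      ∑ (λ j → z j * reduced j i)                                          ≡⟨ ∑-cong (λ j → regroup (z j) pivot (u j (suc i)) (u j zero) (u p (suc i))) ⟩
      ∑ (λ j → pivot * (z j * u j (suc i)) - (z j * u j zero) * u p (suc i))
        ≡⟨ ∑-distrib-- (λ j → pivot * (z j * u j (suc i))) (λ j → (z j * u j zero) * u p (suc i)) ⟩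
      ∑ (λ j → pivot * (z j * u j (suc i))) - ∑ (λ j → (z j * u j zero) * u p (suc i))
        ≡⟨ cong₂ _-_ (sym (*-distribˡ-sum pivot (λ j → z j * u j (suc i)))) (sym (*-distribʳ-sum (u p (suc i)) (λ j → z j * u j zero))) ⟩
      pivot * comb u z (suc i) - comb u z zero * u p (suc i)               ∎
      where
        open ≡-Reasoning
        regroup : ∀ z π a b c → z * (π * a - b * c) ≡ π * (z * a) - (z * b) * c
        regroup = solve-∀

    erase : (Fin n → ℤ) → Fin n → ℤ
    erase z = updateAt z p (λ _ → 0ℤ)

    erase-off-pivot : ∀ z j → j ≢ p → erase z j ≡ z j
    erase-off-pivot z j j≢p = updateAt-minimal j p z j≢p

    comb-reduced-erase : ∀ z i → comb reduced (erase z) i ≡ comb reduced z i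
    comb-reduced-erase z i = ∑-cong termwise
      where
        reduced-pivot : reduced p i ≡ 0ℤ
        reduced-pivot = ℤP.+-inverseʳ (pivot * u p (suc i))
        termwise : ∀ j → erase z j * reduced j i ≡ z j * reduced j i
        termwise j with j ≟ p
        ... | no j≢p = cong (_* reduced j i) (erase-off-pivot z j j≢p)
        ... | yes refl = begin
          erase z p * reduced p i ≡⟨ cong (erase z p *_) reduced-pivot ⟩
          erase z p * 0ℤ          ≡⟨ ℤP.*-zeroʳ (erase z p) ⟩
          0ℤ                      ≡⟨ sym (ℤP.*-zeroʳ (z p)) ⟩
          z p * 0ℤ                ≡⟨ cong (z p *_) reduced-pivot ⟨
          z p * reduced p i       ∎
          where open ≡-Reasoning

    comb-reduced-first-row : ∀ z → comb u z zero ≡ 0ℤ → ∀ i → comb reduced (erase z) i ≡ pivot * comb u z (suc i)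
    comb-reduced-first-row z row₀ i = begin
      comb reduced (erase z) i                                ≡⟨ comb-reduced-erase z i ⟩
      comb reduced z i                                        ≡⟨ comb-reduced z i ⟩
      pivot * comb u z (suc i) - comb u z zero * u p (suc i)  ≡⟨ cong (λ s → pivot * comb u z (suc i) - s * u p (suc i)) row₀ ⟩
      pivot * comb u z (suc i) - 0ℤ * u p (suc i)             ≡⟨ drop (pivot * comb u z (suc i)) (u p (suc i)) ⟩
      pivot * comb u z (suc i)                                ∎
      where
        open ≡-Reasoning
        drop : ∀ a b → a - 0ℤ * b ≡ a
        drop = solve-∀

    reduced-row-vanishes : ∀ z → comb u z zero ≡ 0ℤ → ∀ i → comb u z (suc i) ≡ 0ℤ → comb reduced (erase z) i ≡ 0ℤ
    reduced-row-vanishes z row₀ i rowᵢ =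
      trans (comb-reduced-first-row z row₀ i) (trans (cong (pivot *_) rowᵢ) (ℤP.*-zeroʳ pivot))

    erase-supported : ∀ {S z} → SupportedIn z S → SupportedIn (erase z) (S ∖ p)
    erase-supported {S} {z} z∈S j j∉S∖p with j ≟ p
    ... | yes refl = updateAt-updates p z
    ... | no j≢p with j ∈? S
    ...   | yes j∈S = contradiction (x∈p∧x≢y⇒x∈p-y j∈S j≢p) j∉S∖p
    ...   | no j∉S = trans (erase-off-pivot z j j≢p) (z∈S j j∉S)

    -- If erasing the pivot entry killed z, the first row would read z p * pivot = 0.
    erase-nonzero : ∀ {z} → pivot ≢ 0ℤ → comb u z zero ≡ 0ℤ → Nonzero z → Nonzero (erase z)
    erase-nonzero {z} pivot≢0 row₀ (j₀ , zj₀≢0) with any? (λ j → ¬? (erase z j ℤ.≟ 0ℤ))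
    ... | yes found = found
    ... | no none = contradiction zp≡0 zp≢0
      where
        erased-zero : ∀ j → erase z j ≡ 0ℤ
        erased-zero j = decidable-stable (erase z j ℤ.≟ 0ℤ) (λ ej≢0 → none (j , ej≢0))
        zero-off-pivot : ∀ j → j ≢ p → z j ≡ 0ℤ
        zero-off-pivot j j≢p = trans (sym (erase-off-pivot z j j≢p)) (erased-zero j)
        zp≢0 : z p ≢ 0ℤ
        zp≢0 with j₀ ≟ p
        ... | yes refl = zj₀≢0
        ... | no j₀≢p = contradiction (zero-off-pivot j₀ j₀≢p) zj₀≢0
        zp≡0 : z p ≡ 0ℤ
        zp≡0 = cancel-nonzero pivot≢0 (begin
          pivot * z p       ≡⟨ ℤP.*-comm pivot (z p) ⟩
          z p * u p zero    ≡⟨ ∑-concentrated (λ j → z j * u j zero) p (λ j j≢p → trans (cong (_* u j zero) (zero-off-pivot j j≢p)) (ℤP.*-zeroˡ (u j zero))) ⟨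
          comb u z zero     ≡⟨ row₀ ⟩
          0ℤ                ∎)
          where open ≡-Reasoning

  -- A kernel vector c supported in S shows that the columns in S have rank < ∣ S ∣ₛ,
  -- so fewer than ∣ S ∣ₛ rows already cut out the kernel restricted to S.
  record DeterminingRows {n k} (u : Fin n → Fin k → ℤ) (S : Subset n) : Set where
    field
      rows : Subset k
      fewer : ∣ rows ∣ₛ < ∣ S ∣ₛ
      determine : ∀ z → SupportedIn z S → (∀ i → i ∈ rows → comb u z i ≡ 0ℤ) → InKernel u z

  determining-rows : ∀ {n} k (u : Fin n → Fin k → ℤ) (S : Subset n) (c : Fin n → ℤ) →
    SupportedIn c S → InKernel u c → Nonzero c → DeterminingRows u S
  determining-rows zero u S c c∈S _ (j , cj≢0) = record
    { rows = []
    ; fewer = ℕP.≤-<-trans z≤n (x∈p⇒∣p-x∣<∣p∣ j∈S)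
    ; determine = λ _ _ _ () }
    where
      j∈S : j ∈ S
      j∈S with j ∈? S
      ... | yes j∈S = j∈S
      ... | no j∉S = contradiction (c∈S j j∉S) cj≢0
  determining-rows {n} (suc k) u S c c∈S c∈ker c≢0 with any? (λ j → (j ∈? S) ×-dec ¬? (u j zero ℤ.≟ 0ℤ))
  ... | no no-pivot = record
    { rows = outside ∷ DeterminingRows.rows rest
    ; fewer = DeterminingRows.fewer rest
    ; determine = determine }
    where
      rest : DeterminingRows (λ j i → u j (suc i)) S
      rest = determining-rows k (λ j i → u j (suc i)) S c c∈S (λ i → c∈ker (suc i)) c≢0
      first-row-vanishes : ∀ z → SupportedIn z S → comb u z zero ≡ 0ℤ
      first-row-vanishes z z∈S = trans (∑-cong termwise) (∑-zero n)
        where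
          termwise : ∀ j → z j * u j zero ≡ 0ℤ
          termwise j with j ∈? S
          ... | no j∉S = trans (cong (_* u j zero) (z∈S j j∉S)) (ℤP.*-zeroˡ (u j zero))
          ... | yes j∈S = trans (cong (z j *_) (decidable-stable (u j zero ℤ.≟ 0ℤ) (λ uj≢0 → no-pivot (j , j∈S , uj≢0))))
                                (ℤP.*-zeroʳ (z j))
      determine : ∀ z → SupportedIn z S → (∀ i → i ∈ outside ∷ DeterminingRows.rows rest → comb u z i ≡ 0ℤ) → InKernel u z
      determine z z∈S rows-vanish zero = first-row-vanishes z z∈S
      determine z z∈S rows-vanish (suc i) = DeterminingRows.determine rest z z∈S (λ i i∈rows → rows-vanish (suc i) (there i∈rows)) i
  ... | yes (p , p∈S , pivot≢0) = record
    { rows = inside ∷ DeterminingRows.rows rest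
    ; fewer = ℕP.<-≤-trans (ℕ.s≤s (DeterminingRows.fewer rest)) (x∈p⇒∣p-x∣<∣p∣ p∈S)
    ; determine = determine }
    where
      open Elimination u p
      rest : DeterminingRows reduced (S ∖ p)
      rest = determining-rows k reduced (S ∖ p) (erase c) (erase-supported c∈S)
               (λ i → reduced-row-vanishes c (c∈ker zero) i (c∈ker (suc i)))
               (erase-nonzero pivot≢0 (c∈ker zero) c≢0)
      determine : ∀ z → SupportedIn z S → (∀ i → i ∈ inside ∷ DeterminingRows.rows rest → comb u z i ≡ 0ℤ) → InKernel u z
      determine z z∈S rows-vanish zero = rows-vanish zero here
      determine z z∈S rows-vanish (suc i) = cancel-nonzero pivot≢0 (trans (sym (comb-reduced-first-row z row₀ i)) (reduced-kernel i))
        where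
          row₀ : comb u z zero ≡ 0ℤ
          row₀ = rows-vanish zero here
          reduced-kernel : InKernel reduced (erase z)
          reduced-kernel = DeterminingRows.determine rest (erase z) (erase-supported z∈S)
            (λ i i∈rows → reduced-row-vanishes z row₀ i (rows-vanish (suc i) (there i∈rows)))

module Siegel where

  open import Data.Nat as ℕ using (ℕ; suc; _<_; _≤_; _∸_; _^_; z≤n; s≤s)
  import Data.Nat.Properties as ℕP
  open import Data.Nat.Tactic.RingSolver as ℕSolver using ()
  open import Data.Integer as ℤ using (ℤ; +_; -[1+_]; _+_; _-_; 0ℤ; ∣_∣)
  import Data.Integer.Properties as ℤP
  open import Data.Integer.Tactic.RingSolver using (solve-∀)
  open import Algebra.Properties.AbelianGroup ℤP.+-0-abelianGroup using (∙-cancelʳ)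
  open import Data.Fin using (Fin; suc)
  open import Data.Fin.Properties using (any?)
  open import Data.Fin.Subset using (Subset; _∈_) renaming (∣_∣ to ∣_∣ₛ)
  open import Data.Bool using (true; false; if_then_else_)
  open import Data.Vec using (Vec; lookup; tabulate)
  import Data.Vec.Properties as VecP
  open import Data.Vec.Relation.Binary.Pointwise.Extensional using (ext; Pointwise-≡⇒≡)
  open import Data.List.Membership.Propositional using () renaming (_∈_ to _∈ˡ_)
  open import Data.List using (List; length)
  open import Data.Product using (_,_)
  open import Data.List.Relation.Unary.All as All using (All)
  open import Relation.Nullary using (yes; no; ¬?; contradiction; decidable-stable)
  open import Relation.Binary.PropositionalEquality
  open Sums
  open Subsets
  open Counting
  open Kernel
  open Powers using (*-distrib-^)

  negative-part : ℤ → ℕ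
  negative-part (+ _) = 0
  negative-part -[1+ m ] = suc m

  -- y * u + b * negative-part u, computed in ℕ (it is nonnegative when y ≤ b)
  shifted-product : ℕ → ℕ → ℤ → ℕ
  shifted-product y b (+ m) = y ℕ.* m
  shifted-product y b -[1+ m ] = (b ∸ y) ℕ.* suc m

  shifted-product-≡ : ∀ y b u → y ≤ b → + shifted-product y b u ≡ + y ℤ.* u + + (b ℕ.* negative-part u)
  shifted-product-≡ y b (+ m) y≤b rewrite ℕP.*-zeroʳ b | ℤP.pos-* y m = sym (ℤP.+-identityʳ _)
  shifted-product-≡ y b -[1+ m ] y≤b = begin
    + ((b ∸ y) ℕ.* suc m)                                 ≡⟨ ℤP.pos-* (b ∸ y) (suc m) ⟩
    + (b ∸ y) ℤ.* + suc m                                  ≡⟨ split (+ y) (+ (b ∸ y)) (+ suc m) ⟩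
    + y ℤ.* -[1+ m ] + (+ y + + (b ∸ y)) ℤ.* + suc m       ≡⟨ cong (λ s → + y ℤ.* -[1+ m ] + s ℤ.* + suc m) (ℤP.pos-+ y (b ∸ y)) ⟨
    + y ℤ.* -[1+ m ] + + (y ℕ.+ (b ∸ y)) ℤ.* + suc m       ≡⟨ cong (λ s → + y ℤ.* -[1+ m ] + + s ℤ.* + suc m) (ℕP.m+[n∸m]≡n y≤b) ⟩
    + y ℤ.* -[1+ m ] + + b ℤ.* + suc m                     ≡⟨ cong (_+_ (+ y ℤ.* -[1+ m ])) (ℤP.pos-* b (suc m)) ⟨
    + y ℤ.* -[1+ m ] + + (b ℕ.* suc m)                     ∎
    where
      open ≡-Reasoning
      split : ∀ y e s → e ℤ.* s ≡ y ℤ.* (ℤ.- s) + (y + e) ℤ.* s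
      split = solve-∀

  shifted-product-≤ : ∀ y b u → y ≤ b → shifted-product y b u ≤ b ℕ.* ∣ u ∣
  shifted-product-≤ y b (+ m) y≤b = ℕP.*-monoˡ-≤ m y≤b
  shifted-product-≤ y b -[1+ m ] y≤b = ℕP.*-monoˡ-≤ (suc m) (ℕP.m∸n≤m b y)

  -- Candidate vectors outnumber their possible images.
  siegel-counting : ∀ m M r → r < m → let B = suc (m ℕ.* M) ^ r in suc (m ℕ.* (B ℕ.* M)) ^ r < suc B ^ m
  siegel-counting m M r r<m = begin-strict
    suc (m ℕ.* (B ℕ.* M)) ^ r    ≤⟨ ℕP.^-monoˡ-≤ r image-width ⟩
    (suc (m ℕ.* M) ℕ.* B) ^ r    ≡⟨ *-distrib-^ (suc (m ℕ.* M)) B r ⟩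
    B ℕ.* B ^ r                  ≤⟨ ℕP.^-monoʳ-≤ B ⦃ ℕP.m^n≢0 (suc (m ℕ.* M)) r ⦄ r<m ⟩
    B ^ m                        <⟨ ℕP.^-monoˡ-< m ⦃ ℕ.>-nonZero (ℕP.≤-trans (s≤s z≤n) r<m) ⦄ (ℕP.n<1+n B) ⟩
    suc B ^ m                    ∎
    where
      open ℕP.≤-Reasoning
      B : ℕ
      B = suc (m ℕ.* M) ^ r
      image-width : suc (m ℕ.* (B ℕ.* M)) ≤ suc (m ℕ.* M) ℕ.* B
      image-width = begin
        suc (m ℕ.* (B ℕ.* M))   ≡⟨ cong suc (reorder m B M) ⟩
        suc (m ℕ.* M ℕ.* B)     ≤⟨ ℕP.+-monoˡ-≤ (m ℕ.* M ℕ.* B) (ℕP.m^n>0 (suc (m ℕ.* M)) r) ⟩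
        B ℕ.+ m ℕ.* M ℕ.* B     ∎
        where
          reorder : ∀ m B M → m ℕ.* (B ℕ.* M) ≡ m ℕ.* M ℕ.* B
          reorder = ℕSolver.solve-∀

  record SiegelSolution {n k} (u : Fin n → Fin k → ℤ) (S : Subset n) (R : Subset k) (B : ℕ) : Set where
    field
      z : Fin n → ℤ
      supported : SupportedIn z S
      nonzero : Nonzero z
      bounded : ∀ j → ∣ z j ∣ ≤ B
      solves : ∀ i → i ∈ R → comb u z i ≡ 0ℤ

  -- Siegel's lemma: vectors y with 0 ≤ y ≤ B on S outnumber the possible values of
  -- (comb u y i) for i ∈ R, so two of them collide and their difference solves the rows in R.
  module _ {n k} (u : Fin n → Fin k → ℤ) (M : ℕ) (u≤M : ∀ j i → ∣ u j i ∣ ≤ M)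
           (S : Subset n) (R : Subset k) (R<S : ∣ R ∣ₛ < ∣ S ∣ₛ) where

    private
      m r B W : ℕ
      m = ∣ S ∣ₛ
      r = ∣ R ∣ₛ
      B = suc (m ℕ.* M) ^ r
      W = m ℕ.* (B ℕ.* M)

      bound : Fin n → ℕ
      bound = mask S B

      InBox : Vec ℕ n → Set
      InBox y = ∀ j → lookup y j ≤ bound j

      shift : Fin k → ℕ
      shift i = ∑ℕ (λ j → bound j ℕ.* negative-part (u j i))

      shifted-comb : Vec ℕ n → Fin k → ℕ
      shifted-comb y i = ∑ℕ (λ j → shifted-product (lookup y j) (bound j) (u j i))

      shifted-comb-≡ : ∀ y → InBox y → ∀ i → + shifted-comb y i ≡ comb u (toℤ (lookup y)) i + + shift i
      shifted-comb-≡ y y∈box i = begin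
        + shifted-comb y i
          ≡⟨ pos-∑ℕ (λ j → shifted-product (lookup y j) (bound j) (u j i)) ⟩
        ∑ (λ j → + shifted-product (lookup y j) (bound j) (u j i))
          ≡⟨ ∑-cong (λ j → shifted-product-≡ (lookup y j) (bound j) (u j i) (y∈box j)) ⟩
        ∑ (λ j → toℤ (lookup y) j ℤ.* u j i + + (bound j ℕ.* negative-part (u j i)))
          ≡⟨ ∑-distrib-+ (λ j → toℤ (lookup y) j ℤ.* u j i) (λ j → + (bound j ℕ.* negative-part (u j i))) ⟩
        comb u (toℤ (lookup y)) i + ∑ (λ j → + (bound j ℕ.* negative-part (u j i)))
          ≡⟨ cong (_+_ (comb u (toℤ (lookup y)) i)) (pos-∑ℕ (λ j → bound j ℕ.* negative-part (u j i))) ⟨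
        comb u (toℤ (lookup y)) i + + shift i ∎
        where open ≡-Reasoning

      shifted-comb-≤ : ∀ y → InBox y → ∀ i → shifted-comb y i ≤ W
      shifted-comb-≤ y y∈box i = begin
        shifted-comb y i                   ≤⟨ ∑ℕ-mono-≤ (λ j → shifted-product-≤ (lookup y j) (bound j) (u j i) (y∈box j)) ⟩
        ∑ℕ (λ j → bound j ℕ.* ∣ u j i ∣)   ≤⟨ ∑ℕ-mono-≤ termwise ⟩
        ∑ℕ (mask S (B ℕ.* M))              ≡⟨ ∑ℕ-mask S (B ℕ.* M) ⟩
        W                                  ∎
        where
          open ℕP.≤-Reasoning
          termwise : ∀ j → bound j ℕ.* ∣ u j i ∣ ≤ mask S (B ℕ.* M) j
          termwise j with lookup S j
          ... | true = ℕP.*-monoʳ-≤ B (u≤M j i)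
          ... | false = z≤n

      image : Vec ℕ n → Vec ℕ k
      image y = tabulate (λ i → if lookup R i then shifted-comb y i else 0)

      image-on-R : ∀ y i → i ∈ R → lookup (image y) i ≡ shifted-comb y i
      image-on-R y i i∈R rewrite VecP.lookup∘tabulate (λ i → if lookup R i then shifted-comb y i else 0) i
                               | VecP.[]=⇒lookup i∈R = refl

      candidates : List (Vec ℕ n)
      candidates = box n bound

      images : List (Vec ℕ k)
      images = box k (mask R W)

      images-cover : All (λ y → image y ∈ˡ images) candidates
      images-cover = All.tabulate λ {y} y∈candidates → ∈-box⁺ k (mask R W) (image y) (in-range y (∈-box⁻ n bound y y∈candidates))
        where
          in-range : ∀ y → InBox y → ∀ i → lookup (image y) i ≤ mask R W i
          in-range y y∈box i rewrite VecP.lookup∘tabulate (λ i → if lookup R i then shifted-comb y i else 0) i with lookup R i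
          ... | true = shifted-comb-≤ y y∈box i
          ... | false = z≤n

      fewer-images : length images < length candidates
      fewer-images = begin-strict
        length images          ≤⟨ length-box-≤ R W (mask R W) (λ _ → ℕP.≤-refl) ⟩
        suc W ^ r              <⟨ siegel-counting m M r R<S ⟩
        suc B ^ m              ≤⟨ length-box-≥ S B bound (λ _ → ℕP.≤-refl) ⟩
        length candidates      ∎
        where open ℕP.≤-Reasoning

      module Collision {y₁ y₂ : Vec ℕ n} (y₁∈box : InBox y₁) (y₂∈box : InBox y₂) where

        difference : Fin n → ℤ
        difference j = toℤ (lookup y₁) j - toℤ (lookup y₂) j

        supported : SupportedIn difference S
        supported j j∉S = cong₂ (λ a b → + a - + b) (outside-zero y₁ y₁∈box) (outside-zero y₂ y₂∈box)
          where
            outside-zero : ∀ y → InBox y → lookup y j ≡ 0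
            outside-zero y y∈box with lookup S j in S[j] | y∈box j
            ... | false | y≤0 = ℕP.n≤0⇒n≡0 y≤0
            ... | true | _ = contradiction (VecP.lookup⇒[]= j S S[j]) j∉S

        bounded : ∀ j → ∣ difference j ∣ ≤ B
        bounded j = begin
          ∣ difference j ∣                     ≡⟨ cong ∣_∣ (ℤP.m-n≡m⊖n (lookup y₁ j) (lookup y₂ j)) ⟩
          ∣ lookup y₁ j ℤ.⊖ lookup y₂ j ∣       ≤⟨ ℤP.∣m⊝n∣≤m⊔n (lookup y₁ j) (lookup y₂ j) ⟩
          lookup y₁ j ℕ.⊔ lookup y₂ j           ≤⟨ ℕP.⊔-lub (ℕP.≤-trans (y₁∈box j) bound≤B) (ℕP.≤-trans (y₂∈box j) bound≤B) ⟩
          B                                    ∎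
          where
            open ℕP.≤-Reasoning
            bound≤B : bound j ≤ B
            bound≤B with lookup S j
            ... | true = ℕP.≤-refl
            ... | false = z≤n

        nonzero : y₁ ≢ y₂ → Nonzero difference
        nonzero y₁≢y₂ with any? (λ j → ¬? (lookup y₁ j ℕP.≟ lookup y₂ j))
        ... | yes (j , y₁ⱼ≢y₂ⱼ) = j , λ dⱼ≡0 → y₁ⱼ≢y₂ⱼ (ℤP.+-injective (ℤP.i-j≡0⇒i≡j _ _ dⱼ≡0))
        ... | no agree = contradiction (Pointwise-≡⇒≡ (ext λ j → decidable-stable (lookup y₁ j ℕP.≟ lookup y₂ j) (λ ne → agree (j , ne)))) y₁≢y₂

        solves : image y₁ ≡ image y₂ → ∀ i → i ∈ R → comb u difference i ≡ 0ℤ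
        solves same-image i i∈R = begin
          comb u difference i                                       ≡⟨ comb-sub u (toℤ (lookup y₁)) (toℤ (lookup y₂)) i ⟩
          comb u (toℤ (lookup y₁)) i - comb u (toℤ (lookup y₂)) i   ≡⟨ cong (_- comb u (toℤ (lookup y₂)) i) same-comb ⟩
          comb u (toℤ (lookup y₂)) i - comb u (toℤ (lookup y₂)) i   ≡⟨ ℤP.+-inverseʳ (comb u (toℤ (lookup y₂)) i) ⟩
          0ℤ                                                        ∎
          where
            open ≡-Reasoning
            same-shifted : shifted-comb y₁ i ≡ shifted-comb y₂ i
            same-shifted = trans (sym (image-on-R y₁ i i∈R)) (trans (cong (λ v → lookup v i) same-image) (image-on-R y₂ i i∈R))
            same-comb : comb u (toℤ (lookup y₁)) i ≡ comb u (toℤ (lookup y₂)) i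
            same-comb = ∙-cancelʳ (+ shift i) _ _
              (trans (sym (shifted-comb-≡ y₁ y₁∈box i)) (trans (cong +_ same-shifted) (shifted-comb-≡ y₂ y₂∈box i)))

    opaque
      siegel : SiegelSolution u S R B
      siegel =
        let y₁ , y₂ , y₁∈ , y₂∈ , y₁≢y₂ , same-image =
              pigeonhole image candidates images (box-unique n bound) images-cover fewer-images
            open Collision {y₁} {y₂} (∈-box⁻ n bound y₁ y₁∈) (∈-box⁻ n bound y₂ y₂∈)
        in record
          { z = difference
          ; supported = supported
          ; nonzero = nonzero y₁≢y₂
          ; bounded = bounded
          ; solves = solves same-image }

module KernelVectors where

  open import Data.Nat as ℕ using (ℕ; zero; suc; _<_; _≤_; _∸_; _^_; z≤n; s≤s)
  import Data.Nat.Properties as ℕP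
  open import Data.Nat.Tactic.RingSolver as ℕSolver using ()
  open import Data.Integer as ℤ using (ℤ; +_; -[1+_]; -_; _+_; _*_; _-_; 0ℤ; ∣_∣)
  import Data.Integer.Properties as ℤP
  open import Data.Integer.Tactic.RingSolver using (solve-∀)
  open import Data.Fin using (Fin; zero; suc; _≟_)
  open import Data.Fin.Properties using (any?)
  open import Data.Fin.Subset using (Subset; _∈_; ⊤) renaming (∣_∣ to ∣_∣ₛ; _-_ to _∖_)
  open import Data.Fin.Subset.Properties using (_∈?_; ∈⊤; ∣p∣≤n; x∈p⇒∣p-x∣<∣p∣; x∈p∧x≢y⇒x∈p-y)
  open import Data.Bool using (true; false; if_then_else_)
  open import Data.Vec using (lookup)
  import Data.Vec.Properties as VecP
  open import Data.List using (List; []; _∷_; allFin)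
  import Data.List.Membership.Propositional.Properties as ∈P
  open import Data.List.Relation.Unary.All as All using (All; []; _∷_)
  open import Data.Product using (Σ; _×_; _,_)
  open import Data.Sum using (_⊎_; inj₁; inj₂)
  open import Relation.Nullary using (Dec; yes; no; ¬?; _×-dec_; contradiction; decidable-stable)
  open import Relation.Nullary.Decidable using (⌊_⌋)
  open import Relation.Binary.PropositionalEquality
  open import Function using (_∘_)
  open Sums
  open Subsets
  open Kernel
  open Siegel

  record BoundedKernelVector {n k} (u : Fin n → Fin k → ℤ) (j₁ : Fin n) (Z : ℕ) : Set where
    field
      coeff : Fin n → ℕ
      positive : 1 ≤ coeff j₁
      kernel : InKernel u (toℤ coeff)
      sum≤ : ∑ℕ coeff ≤ Z

  weaken : ∀ {n k} {u : Fin n → Fin k → ℤ} {j₁ Z Z′} → Z ≤ Z′ → BoundedKernelVector u j₁ Z → BoundedKernelVector u j₁ Z′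
  weaken Z≤Z′ v = record { BoundedKernelVector v ; sum≤ = ℕP.≤-trans (BoundedKernelVector.sum≤ v) Z≤Z′ }

  kernel-bound : ℕ → ℕ → ℕ
  kernel-bound k M = suc k ℕ.* suc (suc k ℕ.* M) ^ k

  kernel-bound-mono : ∀ {r k} M → r ≤ k → kernel-bound r M ≤ kernel-bound k M
  kernel-bound-mono {r} {k} M r≤k = ℕP.*-mono-≤ (s≤s r≤k)
    (ℕP.≤-trans (ℕP.^-monoˡ-≤ r (s≤s (ℕP.*-monoˡ-≤ M (s≤s r≤k)))) (ℕP.^-monoʳ-≤ (suc (suc k ℕ.* M)) r≤k))

  unit-sign : ∀ a → a ≢ 0ℤ → Σ ℤ λ ε → ∣ ε ∣ ≡ 1 × Σ ℕ λ m → ε * a ≡ + suc m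
  unit-sign (+ zero) a≢0 = contradiction refl a≢0
  unit-sign (+ suc m) _ = + 1 , refl , m , ℤP.*-identityˡ (+ suc m)
  unit-sign -[1+ m ] _ = - + 1 , refl , m , ℤP.-1*i≡-i -[1+ m ]

  nonneg-of-multiple : ∀ x {m b} → 1 ≤ m → x * + m ≡ + b → + ∣ x ∣ ≡ x
  nonneg-of-multiple (+ _) _ _ = refl
  nonneg-of-multiple -[1+ _ ] {suc _} _ ()

  positive-nonzero : ∀ {m} → 1 ≤ m → + m ≢ 0ℤ
  positive-nonzero 1≤m m≡0 = ℕP.<⇒≢ 1≤m (sym (ℤP.+-injective m≡0))

  Proportional : ∀ {n} → (Fin n → ℤ) → Fin n → (Fin n → ℕ) → Set
  Proportional z j₁ c = ∀ j → z j * + c j₁ ≡ z j₁ * + c j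

  proportional? : ∀ {n} (z : Fin n → ℤ) j₁ c → Proportional z j₁ c ⊎ Σ (Fin n) λ j₀ → z j₀ * + c j₁ ≢ z j₁ * + c j₀
  proportional? z j₁ c with any? (λ j → ¬? (z j * + c j₁ ℤ.≟ z j₁ * + c j))
  ... | yes witness = inj₂ witness
  ... | no none = inj₁ λ j → decidable-stable (z j * + c j₁ ℤ.≟ z j₁ * + c j) (λ ne → none (j , ne))

  proportional-leading-nonzero : ∀ {n} (z : Fin n → ℤ) j₁ c → 1 ≤ c j₁ → Nonzero z → Proportional z j₁ c → z j₁ ≢ 0ℤ
  proportional-leading-nonzero z j₁ c c₁≥1 (j₀ , zj₀≢0) proportional z₁≡0 =
    zj₀≢0 (cancel-nonzero (positive-nonzero c₁≥1) (begin
      + c j₁ * z j₀    ≡⟨ ℤP.*-comm (+ c j₁) (z j₀) ⟩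
      z j₀ * + c j₁    ≡⟨ proportional j₀ ⟩
      z j₁ * + c j₀    ≡⟨ cong (_* + c j₀) z₁≡0 ⟩
      0ℤ               ∎))
    where open ≡-Reasoning

  -- A kernel vector proportional to c is nonnegative once its sign is fixed.
  proportional-kernel-vector : ∀ {n k} (u : Fin n → Fin k → ℤ) j₁ c → 1 ≤ c j₁ →
    ∀ z → InKernel u z → Nonzero z → Proportional z j₁ c →
    Σ (Fin n → ℕ) λ w → (∀ j → w j ≡ ∣ z j ∣) × 1 ≤ w j₁ × InKernel u (toℤ w)
  proportional-kernel-vector u j₁ c c₁≥1 z z∈ker z≢0 proportional
    with unit-sign (z j₁) (proportional-leading-nonzero z j₁ c c₁≥1 z≢0 proportional)
  ... | ε , ∣ε∣≡1 , s , εz₁≡ = (λ j → ∣ ε * z j ∣) , same-abs , positive , kernel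
    where
      nonneg : ∀ j → + ∣ ε * z j ∣ ≡ ε * z j
      nonneg j = nonneg-of-multiple (ε * z j) c₁≥1 (begin
        ε * z j * + c j₁     ≡⟨ ℤP.*-assoc ε (z j) (+ c j₁) ⟩
        ε * (z j * + c j₁)   ≡⟨ cong (ε *_) (proportional j) ⟩
        ε * (z j₁ * + c j)   ≡⟨ ℤP.*-assoc ε (z j₁) (+ c j) ⟨
        ε * z j₁ * + c j     ≡⟨ cong (_* + c j) εz₁≡ ⟩
        + suc s * + c j      ≡⟨ ℤP.pos-* (suc s) (c j) ⟨
        + (suc s ℕ.* c j)    ∎)
        where open ≡-Reasoning
      same-abs : ∀ j → ∣ ε * z j ∣ ≡ ∣ z j ∣
      same-abs j = trans (ℤP.abs-* ε (z j)) (trans (cong (ℕ._* ∣ z j ∣) ∣ε∣≡1) (ℕP.*-identityˡ ∣ z j ∣))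
      positive : 1 ≤ ∣ ε * z j₁ ∣
      positive = subst (1 ≤_) (cong ∣_∣ (sym εz₁≡)) (s≤s z≤n)
      kernel : InKernel u (λ j → + ∣ ε * z j ∣)
      kernel i = trans (comb-cong u nonneg i) (InKernel-scale u ε z z∈ker i)

  -- c p / y p ≤ c j / y j for every j with y j > 0, cross-multiplied.
  record MinimalRatio {n} (c : Fin n → ℕ) (y : Fin n → ℤ) : Set where
    field
      p : Fin n
      s : ℕ
      y-p : y p ≡ + suc s
      minimal : ∀ j m → y j ≡ + suc m → c p ℕ.* suc m ≤ suc s ℕ.* c j

  module _ {n} (c : Fin n → ℕ) (y : Fin n → ℤ) where

    private
      RatioAtMost : Fin n → ℕ → Fin n → Set
      RatioAtMost a sa j = ∀ m → y j ≡ + suc m → c a ℕ.* suc m ≤ suc sa ℕ.* c j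

      ratio-trans : ∀ a sa b sb e se → c a ℕ.* suc sb ≤ suc sa ℕ.* c b → c b ℕ.* suc se ≤ suc sb ℕ.* c e →
        c a ℕ.* suc se ≤ suc sa ℕ.* c e
      ratio-trans a sa b sb e se a≤b b≤e = ℕP.*-cancelʳ-≤ (c a ℕ.* suc se) (suc sa ℕ.* c e) (suc sb) (begin
        c a ℕ.* suc se ℕ.* suc sb      ≡⟨ swap (c a) (suc se) (suc sb) ⟩
        c a ℕ.* suc sb ℕ.* suc se      ≤⟨ ℕP.*-monoˡ-≤ (suc se) a≤b ⟩
        suc sa ℕ.* c b ℕ.* suc se      ≡⟨ ℕP.*-assoc (suc sa) (c b) (suc se) ⟩
        suc sa ℕ.* (c b ℕ.* suc se)    ≤⟨ ℕP.*-monoʳ-≤ (suc sa) b≤e ⟩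
        suc sa ℕ.* (suc sb ℕ.* c e)    ≡⟨ regroup (suc sa) (suc sb) (c e) ⟩
        suc sa ℕ.* c e ℕ.* suc sb      ∎)
        where
          open ℕP.≤-Reasoning
          swap : ∀ x y z → x ℕ.* y ℕ.* z ≡ x ℕ.* z ℕ.* y
          swap = ℕSolver.solve-∀
          regroup : ∀ x y z → x ℕ.* (y ℕ.* z) ≡ x ℕ.* z ℕ.* y
          regroup = ℕSolver.solve-∀

      positive-unique : ∀ {j m m′} → y j ≡ + suc m → y j ≡ + suc m′ → m ≡ m′
      positive-unique eq eq′ = ℕP.suc-injective (ℤP.+-injective (trans (sym eq) eq′))

      least : (js : List (Fin n)) (a : Fin n) (sa : ℕ) → y a ≡ + suc sa →
        Σ (Fin n) λ b → Σ ℕ λ sb → y b ≡ + suc sb × All (RatioAtMost b sb) js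
      least [] a sa ya = a , sa , ya , []
      least (j ∷ js) a sa ya with least js a sa ya
      ... | b , sb , yb , b≤js with y j in yj
      ...   | + zero = b , sb , yb , (λ _ ym → contradiction (trans (sym yj) ym) λ ()) ∷ b≤js
      ...   | -[1+ _ ] = b , sb , yb , (λ _ ym → contradiction (trans (sym yj) ym) λ ()) ∷ b≤js
      ...   | + suc sj with ℕP.≤-total (c b ℕ.* suc sj) (suc sb ℕ.* c j)
      ...     | inj₁ b≤j = b , sb , yb , (λ m ym → subst (λ t → c b ℕ.* suc t ≤ suc sb ℕ.* c j) (positive-unique yj ym) b≤j) ∷ b≤js
      ...     | inj₂ j≤b = j , sj , yj ,
                            (λ m ym → subst (λ t → c j ℕ.* suc t ≤ suc sj ℕ.* c j) (positive-unique yj ym) (ℕP.≤-reflexive (ℕP.*-comm (c j) (suc sj))))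
                            ∷ All.map (λ b≤e m ye → ratio-trans j sj b sb _ m j≤b′ (b≤e m ye)) b≤js
        where
          j≤b′ : c j ℕ.* suc sb ≤ suc sj ℕ.* c b
          j≤b′ = subst₂ _≤_ (ℕP.*-comm (suc sb) (c j)) (ℕP.*-comm (c b) (suc sj)) j≤b

    minimal-ratio : ∀ j₀ s₀ → y j₀ ≡ + suc s₀ → MinimalRatio c y
    minimal-ratio j₀ s₀ y₀ with least (allFin n) j₀ s₀ y₀
    ... | p , s , y-p , p≤all = record
      { p = p ; s = s ; y-p = y-p
      ; minimal = λ j → All.lookup p≤all (∈P.∈-allFin j) }

  -- suc s · cⱼ − cₚ · y in ℕ, exact when cₚ / suc s ≤ cⱼ / y for y > 0.
  reduced-coefficient : (cⱼ cₚ s : ℕ) → ℤ → ℕ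
  reduced-coefficient cⱼ cₚ s (+ m) = suc s ℕ.* cⱼ ∸ cₚ ℕ.* m
  reduced-coefficient cⱼ cₚ s -[1+ m ] = suc s ℕ.* cⱼ ℕ.+ cₚ ℕ.* suc m

  reduced-coefficient-≡ : ∀ cⱼ cₚ s y → (∀ m → y ≡ + suc m → cₚ ℕ.* suc m ≤ suc s ℕ.* cⱼ) →
    + reduced-coefficient cⱼ cₚ s y ≡ + suc s * + cⱼ - + cₚ * y
  reduced-coefficient-≡ cⱼ cₚ s (+ m) minimal = begin
    + (suc s ℕ.* cⱼ ∸ cₚ ℕ.* m)             ≡⟨ ℤP.⊖-≥ cₚm≤ ⟨
    suc s ℕ.* cⱼ ℤ.⊖ cₚ ℕ.* m               ≡⟨ ℤP.m-n≡m⊖n (suc s ℕ.* cⱼ) (cₚ ℕ.* m) ⟨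
    + (suc s ℕ.* cⱼ) - + (cₚ ℕ.* m)         ≡⟨ cong₂ _-_ (ℤP.pos-* (suc s) cⱼ) (ℤP.pos-* cₚ m) ⟩
    + suc s * + cⱼ - + cₚ * + m             ∎
    where
      open ≡-Reasoning
      cₚm≤ : cₚ ℕ.* m ≤ suc s ℕ.* cⱼ
      cₚm≤ = bounded m minimal
        where
          bounded : ∀ m → (∀ m′ → + m ≡ + suc m′ → cₚ ℕ.* suc m′ ≤ suc s ℕ.* cⱼ) → cₚ ℕ.* m ≤ suc s ℕ.* cⱼ
          bounded zero _ = subst (_≤ suc s ℕ.* cⱼ) (sym (ℕP.*-zeroʳ cₚ)) z≤n
          bounded (suc m′) minimal = minimal m′ refl
  reduced-coefficient-≡ cⱼ cₚ s -[1+ m ] _ = begin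
    + (suc s ℕ.* cⱼ ℕ.+ cₚ ℕ.* suc m)       ≡⟨ ℤP.pos-+ (suc s ℕ.* cⱼ) (cₚ ℕ.* suc m) ⟩
    + (suc s ℕ.* cⱼ) + + (cₚ ℕ.* suc m)     ≡⟨ cong₂ _+_ (ℤP.pos-* (suc s) cⱼ) (ℤP.pos-* cₚ (suc m)) ⟩
    + suc s * + cⱼ + + cₚ * + suc m         ≡⟨ subtract-negative (+ suc s * + cⱼ) (+ cₚ) (+ suc m) ⟩
    + suc s * + cⱼ - + cₚ * -[1+ m ]        ∎
    where
      open ≡-Reasoning
      subtract-negative : ∀ a b x → a + b * x ≡ a - b * (- x)
      subtract-negative = solve-∀

  record SmallerSupport {n k} (u : Fin n → Fin k → ℤ) (j₁ : Fin n) (S : Subset n) : Set where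
    field
      support : Subset n
      smaller : ∣ support ∣ₛ < ∣ S ∣ₛ
      coeff : Fin n → ℕ
      supported : SupportedIn (toℤ coeff) support
      positive : 1 ≤ coeff j₁
      kernel : InKernel u (toℤ coeff)

  module _ {n k} (u : Fin n → Fin k → ℤ) (j₁ : Fin n) (S : Subset n) (c : Fin n → ℕ)
           (c∈S : SupportedIn (toℤ c) S) (c₁≥1 : 1 ≤ c j₁) (c∈ker : InKernel u (toℤ c)) where

    -- Subtract from c the largest multiple of y keeping it nonnegative; the minimising index drops out.
    reduce-along : ∀ y → SupportedIn y S → InKernel u y → y j₁ ≡ 0ℤ → MinimalRatio c y → SmallerSupport u j₁ S
    reduce-along y y∈S y∈ker y₁≡0 ratio = record
      { support = S ∖ p
      ; smaller = x∈p⇒∣p-x∣<∣p∣ p∈S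
      ; coeff = coeff
      ; supported = supported
      ; positive = positive
      ; kernel = λ i → trans (comb-cong u coeff-≡ i) (InKernel-linear u (+ suc s) (+ c p) (toℤ c) y c∈ker y∈ker i) }
      where
        open MinimalRatio ratio
        coeff : Fin n → ℕ
        coeff j = reduced-coefficient (c j) (c p) s (y j)
        coeff-≡ : ∀ j → + coeff j ≡ + suc s * + c j - + c p * y j
        coeff-≡ j = reduced-coefficient-≡ (c j) (c p) s (y j) (minimal j)
        p∈S : p ∈ S
        p∈S with p ∈? S
        ... | yes p∈S = p∈S
        ... | no p∉S = contradiction (trans (sym y-p) (y∈S p p∉S)) λ ()
        supported : SupportedIn (toℤ coeff) (S ∖ p)
        supported j j∉S∖p with j ≟ p
        ... | yes refl = trans (coeff-≡ p) (trans (cong (λ t → + suc s * + c p - + c p * t) y-p) (cancel (+ suc s) (+ c p)))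
          where
            cancel : ∀ a b → a * b - b * a ≡ 0ℤ
            cancel = solve-∀
        ... | no j≢p with j ∈? S
        ...   | yes j∈S = contradiction (x∈p∧x≢y⇒x∈p-y j∈S j≢p) j∉S∖p
        ...   | no j∉S = trans (coeff-≡ j) (trans (cong₂ (λ a b → + suc s * a - + c p * b) (c∈S j j∉S) (y∈S j j∉S)) (vanish (+ suc s) (+ c p)))
          where
            vanish : ∀ a b → a * 0ℤ - b * 0ℤ ≡ 0ℤ
            vanish = solve-∀
        positive : 1 ≤ coeff j₁
        positive = subst (1 ≤_) (sym coeff₁≡) (ℕP.*-mono-≤ {1} {suc s} (s≤s z≤n) c₁≥1)
          where
            coeff₁≡ : coeff j₁ ≡ suc s ℕ.* c j₁
            coeff₁≡ = ℤP.+-injective (begin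
              + coeff j₁                                ≡⟨ coeff-≡ j₁ ⟩
              + suc s * + c j₁ - + c p * y j₁            ≡⟨ cong (λ t → + suc s * + c j₁ - + c p * t) y₁≡0 ⟩
              + suc s * + c j₁ - + c p * 0ℤ              ≡⟨ drop (+ suc s * + c j₁) (+ c p) ⟩
              + suc s * + c j₁                           ≡⟨ ℤP.pos-* (suc s) (c j₁) ⟨
              + (suc s ℕ.* c j₁)                         ∎)
              where
                open ≡-Reasoning
                drop : ∀ a b → a - b * 0ℤ ≡ a
                drop = solve-∀

    cross-difference : (Fin n → ℤ) → Fin n → ℤ
    cross-difference z j = + c j₁ * z j - z j₁ * + c j

    -- c j₁ · z − z j₁ · c is a kernel vector vanishing at j₁ but not at j₀.
    reduce-support : ∀ z → SupportedIn z S → InKernel u z → ∀ j₀ → z j₀ * + c j₁ ≢ z j₁ * + c j₀ → SmallerSupport u j₁ S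
    reduce-support z z∈S z∈ker j₀ not-proportional with unit-sign (cross-difference z j₀) x₀≢0
      where
        x₀≢0 : cross-difference z j₀ ≢ 0ℤ
        x₀≢0 x₀≡0 = not-proportional (trans (ℤP.*-comm (z j₀) (+ c j₁)) (ℤP.i-j≡0⇒i≡j _ _ x₀≡0))
    ... | ε , _ , s₀ , εx₀≡ = reduce-along y y∈S y∈ker y₁≡0 (minimal-ratio c y j₀ s₀ εx₀≡)
      where
        y : Fin n → ℤ
        y j = ε * cross-difference z j
        y∈S : SupportedIn y S
        y∈S j j∉S = trans (cong₂ (λ a b → ε * (+ c j₁ * a - z j₁ * b)) (z∈S j j∉S) (c∈S j j∉S)) (vanish ε (+ c j₁) (z j₁))
          where
            vanish : ∀ e a b → e * (a * 0ℤ - b * 0ℤ) ≡ 0ℤ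
            vanish = solve-∀
        y∈ker : InKernel u y
        y∈ker = InKernel-scale u ε (cross-difference z) (InKernel-linear u (+ c j₁) (z j₁) z (toℤ c) z∈ker c∈ker)
        y₁≡0 : y j₁ ≡ 0ℤ
        y₁≡0 = cancel ε (+ c j₁) (z j₁)
          where
            cancel : ∀ e a b → e * (a * b - b * a) ≡ 0ℤ
            cancel = solve-∀

  ∑-abs-≤ : ∀ {n} (S : Subset n) B (z : Fin n → ℤ) → SupportedIn z S → (∀ j → ∣ z j ∣ ≤ B) → ∑ℕ (λ j → ∣ z j ∣) ≤ ∣ S ∣ₛ ℕ.* B
  ∑-abs-≤ S B z z∈S z≤B = ℕP.≤-trans (∑ℕ-mono-≤ pointwise) (ℕP.≤-reflexive (∑ℕ-mask S B))
    where
      pointwise : ∀ j → ∣ z j ∣ ≤ mask S B j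
      pointwise j with lookup S j in S[j]
      ... | true = z≤B j
      ... | false = ℕP.≤-reflexive (cong ∣_∣ (z∈S j (λ j∈S → contradiction (trans (sym (VecP.[]=⇒lookup j∈S)) S[j]) λ ())))

  module _ {n k} (u : Fin n → Fin k → ℤ) (M : ℕ) (u≤M : ∀ j i → ∣ u j i ∣ ≤ M) (j₁ : Fin n) where

    -- The rank lemma and Siegel's lemma give a small kernel vector z supported in S;
    -- either z is proportional to c, or it shrinks the support of c.
    one-round : ∀ (S : Subset n) c → SupportedIn (toℤ c) S → 1 ≤ c j₁ → InKernel u (toℤ c) →
      BoundedKernelVector u j₁ (kernel-bound k M) ⊎ SmallerSupport u j₁ S
    one-round S c c∈S c₁≥1 c∈ker with determining-rows k u S (toℤ c) c∈S c∈ker (j₁ , positive-nonzero c₁≥1)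
    ... | record { rows = R ; fewer = R<S ; determine = determine } with subset-of-size S (suc ∣ R ∣ₛ) R<S
    ... | S′ , S′⊆S , ∣S′∣≡ = conclude (proportional? z j₁ c)
      where
        open SiegelSolution (siegel u M u≤M S′ R (subst (∣ R ∣ₛ <_) (sym ∣S′∣≡) ℕP.≤-refl))
        z∈S : SupportedIn z S
        z∈S j j∉S = supported j (λ j∈S′ → j∉S (S′⊆S j∈S′))
        z∈ker : InKernel u z
        z∈ker = determine z z∈S solves
        conclude : Proportional z j₁ c ⊎ Σ (Fin n) (λ j₀ → z j₀ * + c j₁ ≢ z j₁ * + c j₀) →
          BoundedKernelVector u j₁ (kernel-bound k M) ⊎ SmallerSupport u j₁ S
        conclude (inj₂ (j₀ , not-proportional)) = inj₂ (reduce-support u j₁ S c c∈S c₁≥1 c∈ker z z∈S z∈ker j₀ not-proportional)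
        conclude (inj₁ proportional) with proportional-kernel-vector u j₁ c c₁≥1 z z∈ker nonzero proportional
        ... | w , w≡∣z∣ , w₁≥1 , w∈ker = inj₁ record { coeff = w ; positive = w₁≥1 ; kernel = w∈ker ; sum≤ = sum≤ }
          where
            open ℕP.≤-Reasoning
            sum≤ : ∑ℕ w ≤ kernel-bound k M
            sum≤ = begin
              ∑ℕ w                                          ≡⟨ ∑ℕ-cong w≡∣z∣ ⟩
              ∑ℕ (λ j → ∣ z j ∣)                            ≤⟨ ∑-abs-≤ S′ _ z supported bounded ⟩
              ∣ S′ ∣ₛ ℕ.* suc (∣ S′ ∣ₛ ℕ.* M) ^ ∣ R ∣ₛ       ≡⟨ cong (λ m → m ℕ.* suc (m ℕ.* M) ^ ∣ R ∣ₛ) ∣S′∣≡ ⟩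
              kernel-bound ∣ R ∣ₛ M                         ≤⟨ kernel-bound-mono M (∣p∣≤n R) ⟩
              kernel-bound k M                              ∎

    shrink : ∀ N (S : Subset n) → ∣ S ∣ₛ ≤ N → ∀ c → SupportedIn (toℤ c) S → 1 ≤ c j₁ → InKernel u (toℤ c) →
      BoundedKernelVector u j₁ (kernel-bound k M)
    shrink zero S ∣S∣≤0 c c∈S c₁≥1 _ = contradiction ∣S∣≤0 (ℕP.<⇒≱ (ℕP.≤-<-trans z≤n (x∈p⇒∣p-x∣<∣p∣ j₁∈S)))
      where
        j₁∈S : j₁ ∈ S
        j₁∈S with j₁ ∈? S
        ... | yes j₁∈S = j₁∈S
        ... | no j₁∉S = contradiction (c∈S j₁ j₁∉S) (positive-nonzero c₁≥1)
    shrink (suc N) S ∣S∣≤ c c∈S c₁≥1 c∈ker with one-round S c c∈S c₁≥1 c∈ker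
    ... | inj₁ done = done
    ... | inj₂ reduction = shrink N support (ℕP.≤-pred (ℕP.<-≤-trans smaller ∣S∣≤)) coeff supported positive kernel
      where open SmallerSupport reduction

  bounded-kernel-vector : ∀ {n k} (u : Fin n → Fin k → ℤ) M → (∀ j i → ∣ u j i ∣ ≤ M) → ∀ j₁ (c : Fin n → ℕ) →
    1 ≤ c j₁ → InKernel u (toℤ c) → BoundedKernelVector u j₁ (kernel-bound k M)
  bounded-kernel-vector {n} u M u≤M j₁ c = shrink u M u≤M j₁ n ⊤ (∣p∣≤n ⊤) c (λ _ j∉⊤ → contradiction ∈⊤ j∉⊤)

  unit : ∀ {n} → Fin n → Fin n → ℕ
  unit p j = if ⌊ j ≟ p ⌋ then 1 else 0

  unit-on : ∀ {n} (p : Fin n) → unit p p ≡ 1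
  unit-on p with p ≟ p
  ... | yes _ = refl
  ... | no p≢p = contradiction refl p≢p

  unit-off : ∀ {n} {p j : Fin n} → j ≢ p → unit p j ≡ 0
  unit-off {p = p} {j} j≢p with j ≟ p
  ... | yes j≡p = contradiction j≡p j≢p
  ... | no _ = refl

  ∑-unit : ∀ {n} (p : Fin n) (f : Fin n → ℤ) → ∑ (λ j → + unit p j * f j) ≡ f p
  ∑-unit p f = begin
    ∑ (λ j → + unit p j * f j)   ≡⟨ ∑-concentrated (λ j → + unit p j * f j) p (λ j j≢p → cong (λ t → + t * f j) (unit-off j≢p)) ⟩
    + unit p p * f p             ≡⟨ cong (λ t → + t * f p) (unit-on p) ⟩
    + 1 * f p                    ≡⟨ ℤP.*-identityˡ (f p) ⟩
    f p                          ∎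
    where open ≡-Reasoning

  ∑ℕ-unit : ∀ {n} (p : Fin n) → ∑ℕ (unit p) ≡ 1
  ∑ℕ-unit p = ℤP.+-injective (trans (pos-∑ℕ (unit p)) (trans (∑-cong λ j → sym (ℤP.*-identityʳ (+ unit p j))) (∑-unit p (λ _ → + 1))))

  trivial-kernel-vector : ∀ {n k} (u : Fin n → Fin k → ℤ) j₁ → (∀ i → u j₁ i ≡ 0ℤ) → BoundedKernelVector u j₁ 1
  trivial-kernel-vector u j₁ u₁≡0 = record
    { coeff = unit j₁
    ; positive = ℕP.≤-reflexive (sym (unit-on j₁))
    ; kernel = λ i → trans (∑-unit j₁ (λ j → u j i)) (u₁≡0 i)
    ; sum≤ = ℕP.≤-reflexive (∑ℕ-unit j₁) }

  comb-unit : ∀ {n k} (u : Fin n → Fin k → ℤ) p i → comb u (toℤ (unit p)) i ≡ u p i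
  comb-unit u p i = ∑-unit p (λ j → u j i)

  negative-term : ∀ {n} (c : Fin n → ℕ) (v : Fin n → ℤ) j₁ p → 1 ≤ c j₁ → v j₁ ≡ + suc p →
    ∑ (λ j → + c j * v j) ≡ 0ℤ → Σ (Fin n) λ j → 1 ≤ c j × Σ ℕ λ m → v j ≡ -[1+ m ]
  negative-term c v j₁ p c₁≥1 v₁≡ ∑≡0 with any? (λ j → (1 ℕ.≤? c j) ×-dec negative? (v j))
    where
      negative? : ∀ x → Dec (Σ ℕ λ m → x ≡ -[1+ m ])
      negative? (+ _) = no λ { (_ , ()) }
      negative? -[1+ m ] = yes (m , refl)
  ... | yes found = found
  ... | no none = contradiction (ℤP.+-injective (trans (pos-∑ℕ (λ j → c j ℕ.* ∣ v j ∣)) (trans (∑-cong (λ j → sym (nonneg-term j))) ∑≡0)))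
                                (ℕP.<⇒≢ (ℕP.<-≤-trans positive (term≤∑ℕ (λ j → c j ℕ.* ∣ v j ∣) j₁)) ∘ sym)
    where
      nonneg-term : ∀ j → + c j * v j ≡ + (c j ℕ.* ∣ v j ∣)
      nonneg-term j with c j in cⱼ | v j in vⱼ
      ... | zero | x = ℤP.*-zeroˡ x
      ... | suc c′ | + m = sym (ℤP.pos-* (suc c′) m)
      ... | suc _ | -[1+ m ] = contradiction (subst (1 ≤_) (sym cⱼ) (s≤s z≤n) , m , vⱼ) (λ neg → none (j , neg))
      positive : 0 < c j₁ ℕ.* ∣ v j₁ ∣
      positive = ℕP.*-mono-≤ c₁≥1 (subst (1 ≤_) (cong ∣_∣ (sym v₁≡)) (s≤s z≤n))

  two-point : ∀ {n} → Fin n → Fin n → ℕ → ℕ → Fin n → ℕ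
  two-point p q a b j = a ℕ.* unit p j ℕ.+ b ℕ.* unit q j

  comb-two-point : ∀ {n k} (u : Fin n → Fin k → ℤ) p q a b i → comb u (toℤ (two-point p q a b)) i ≡ + a * u p i + + b * u q i
  comb-two-point u p q a b i = begin
    comb u (toℤ (two-point p q a b)) i
      ≡⟨ comb-cong u (λ j → trans (ℤP.pos-+ (a ℕ.* unit p j) (b ℕ.* unit q j)) (cong₂ _+_ (ℤP.pos-* a (unit p j)) (ℤP.pos-* b (unit q j)))) i ⟩
    comb u (λ j → + a * toℤ (unit p) j + + b * toℤ (unit q) j) i
      ≡⟨ comb-+ u (λ j → + a * toℤ (unit p) j) (λ j → + b * toℤ (unit q) j) i ⟩
    comb u (λ j → + a * toℤ (unit p) j) i + comb u (λ j → + b * toℤ (unit q) j) i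
      ≡⟨ cong₂ _+_ (comb-scale u (+ a) (toℤ (unit p)) i) (comb-scale u (+ b) (toℤ (unit q)) i) ⟩
    + a * comb u (toℤ (unit p)) i + + b * comb u (toℤ (unit q)) i
      ≡⟨ cong₂ (λ s t → + a * s + + b * t) (comb-unit u p i) (comb-unit u q i) ⟩
    + a * u p i + + b * u q i ∎
    where open ≡-Reasoning

  ∑ℕ-two-point : ∀ {n} (p q : Fin n) a b → ∑ℕ (two-point p q a b) ≡ a ℕ.+ b
  ∑ℕ-two-point p q a b = begin
    ∑ℕ (two-point p q a b)                             ≡⟨ ℕΣ.∑-distrib-+ (λ j → a ℕ.* unit p j) (λ j → b ℕ.* unit q j) ⟩
    ∑ℕ (λ j → a ℕ.* unit p j) ℕ.+ ∑ℕ (λ j → b ℕ.* unit q j)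
      ≡⟨ cong₂ ℕ._+_ (sym (ℕΣ.*-distribˡ-sum a (unit p))) (sym (ℕΣ.*-distribˡ-sum b (unit q))) ⟩
    a ℕ.* ∑ℕ (unit p) ℕ.+ b ℕ.* ∑ℕ (unit q)              ≡⟨ cong₂ (λ s t → a ℕ.* s ℕ.+ b ℕ.* t) (∑ℕ-unit p) (∑ℕ-unit q) ⟩
    a ℕ.* 1 ℕ.+ b ℕ.* 1                                 ≡⟨ cong₂ ℕ._+_ (ℕP.*-identityʳ a) (ℕP.*-identityʳ b) ⟩
    a ℕ.+ b                                             ∎
    where open ≡-Reasoning

  -- With a single row, one positive and one negative entry already give a kernel vector.
  one-dimensional : ∀ {n} (u : Fin n → Fin 1 → ℤ) M → (∀ j i → ∣ u j i ∣ ≤ M) → ∀ j₁ (c : Fin n → ℕ) →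
    1 ≤ c j₁ → InKernel u (toℤ c) → BoundedKernelVector u j₁ (suc (2 ℕ.* M))
  one-dimensional {n} u M u≤M j₁ c c₁≥1 c∈ker with u j₁ zero ℤ.≟ 0ℤ
  ... | yes u₁≡0 = weaken (s≤s z≤n) (trivial-kernel-vector u j₁ λ { zero → u₁≡0 })
  ... | no u₁≢0 with unit-sign (u j₁ zero) u₁≢0
  ... | ε , ∣ε∣≡1 , p , εu₁≡
    with negative-term c (λ j → ε * u j zero) j₁ p c₁≥1 εu₁≡
           (trans (comb-scale-columns u ε (toℤ c) zero) (trans (cong (ε *_) (c∈ker zero)) (ℤP.*-zeroʳ ε)))
  ... | jₙ , _ , m , εuₙ≡ = record
    { coeff = coeff
    ; positive = ℕP.≤-trans (subst (λ t → 1 ≤ suc m ℕ.* t) (sym (unit-on j₁)) (s≤s z≤n)) (ℕP.m≤m+n _ _)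
    ; kernel = λ { zero → cancel-nonzero ε≢0 scaled-kernel }
    ; sum≤ = sum≤ }
    where
      coeff : Fin n → ℕ
      coeff = two-point j₁ jₙ (suc m) (suc p)
      ε≢0 : ε ≢ 0ℤ
      ε≢0 ε≡0 = contradiction (trans (sym ∣ε∣≡1) (cong ∣_∣ ε≡0)) λ ()
      scaled-kernel : ε * comb u (toℤ coeff) zero ≡ 0ℤ
      scaled-kernel = begin
        ε * comb u (toℤ coeff) zero                     ≡⟨ comb-scale-columns u ε (toℤ coeff) zero ⟨
        comb (λ j i → ε * u j i) (toℤ coeff) zero       ≡⟨ comb-two-point (λ j i → ε * u j i) j₁ jₙ (suc m) (suc p) zero ⟩
        + suc m * (ε * u j₁ zero) + + suc p * (ε * u jₙ zero) ≡⟨ cong₂ (λ s t → + suc m * s + + suc p * t) εu₁≡ εuₙ≡ ⟩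
        + suc m * + suc p + + suc p * - + suc m         ≡⟨ cancel (+ suc m) (+ suc p) ⟩
        0ℤ                                              ∎
        where
          open ≡-Reasoning
          cancel : ∀ a b → a * b + b * (- a) ≡ 0ℤ
          cancel = solve-∀
      scaled-≤ : ∀ j → ∣ ε * u j zero ∣ ≤ M
      scaled-≤ j = subst (_≤ M) (sym (trans (ℤP.abs-* ε (u j zero)) (trans (cong (ℕ._* ∣ u j zero ∣) ∣ε∣≡1) (ℕP.*-identityˡ _)))) (u≤M j zero)
      sum≤ : ∑ℕ coeff ≤ suc (2 ℕ.* M)
      sum≤ = begin
        ∑ℕ coeff             ≡⟨ ∑ℕ-two-point j₁ jₙ (suc m) (suc p) ⟩
        suc m ℕ.+ suc p      ≤⟨ ℕP.+-mono-≤ (subst (_≤ M) (cong ∣_∣ εuₙ≡) (scaled-≤ jₙ)) (subst (_≤ M) (cong ∣_∣ εu₁≡) (scaled-≤ j₁)) ⟩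
        M ℕ.+ M              ≡⟨ cong (M ℕ.+_) (ℕP.+-identityʳ M) ⟨
        2 ℕ.* M              ≤⟨ ℕP.n≤1+n _ ⟩
        suc (2 ℕ.* M)        ∎
        where open ℕP.≤-Reasoning

module Bounds where

  open import Data.Nat as ℕ using (ℕ; suc; _≤_; _+_; _*_; _^_; z≤n; s≤s)
  import Data.Nat.Properties as ℕP
  open import Data.Nat.Tactic.RingSolver using (solve-∀)
  open import Data.Sum using (_⊎_; inj₁; inj₂)
  open import Relation.Binary.PropositionalEquality
  open Powers
  open KernelVectors using (kernel-bound)

  open ℕP.≤-Reasoning

  power-mono : ∀ x {m n} → 1 ≤ x → m ≤ n → x ^ m ≤ x ^ n
  power-mono (suc x) _ m≤n = ℕP.^-monoʳ-≤ (suc x) m≤n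

  n≤n*[n+1] : ∀ n → n ≤ n * (n + 1)
  n≤n*[n+1] n = ℕP.≤-trans (ℕP.≤-reflexive (sym (ℕP.*-identityʳ n))) (ℕP.*-monoʳ-≤ n (ℕP.m≤n+m 1 n))

  -- The bound when every cycle has displacement 0 (kernel vector of size 1).
  flow-bound-trivial : ∀ q y d → 1 ≤ q → 1 ≤ y → 1 ≤ d ⊎ q ≤ 1 → q * y ^ d * (1 * q) ≤ (q * y) ^ (d * (d + 1))
  flow-bound-trivial q y d q≥1 y≥1 (inj₂ q≤1) with ℕP.≤-antisym q≤1 q≥1
  ... | refl = begin
    1 * y ^ d * (1 * 1)        ≡⟨ simplify (y ^ d) ⟩
    y ^ d                      ≤⟨ power-mono y y≥1 (n≤n*[n+1] d) ⟩
    y ^ (d * (d + 1))          ≡⟨ cong (_^ (d * (d + 1))) (ℕP.*-identityˡ y) ⟨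
    (1 * y) ^ (d * (d + 1))    ∎
    where
      simplify : ∀ z → 1 * z * (1 * 1) ≡ z
      simplify = solve-∀
  flow-bound-trivial q y (suc d) q≥1 y≥1 (inj₁ _) = begin
    q * y ^ D * (1 * q)                  ≡⟨ reorder q (y ^ D) ⟩
    q ^ 2 * y ^ D                        ≤⟨ ℕP.*-mono-≤ (power-mono q q≥1 two≤) (power-mono y y≥1 (n≤n*[n+1] D)) ⟩
    q ^ (D * (D + 1)) * y ^ (D * (D + 1)) ≡⟨ *-distrib-^ q y (D * (D + 1)) ⟨
    (q * y) ^ (D * (D + 1))              ∎
    where
      D : ℕ
      D = suc d
      reorder : ∀ q z → q * z * (1 * q) ≡ q * (q * 1) * z
      reorder = solve-∀
      two≤ : 2 ≤ D * (D + 1)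
      two≤ = ℕP.*-mono-≤ {1} {D} {2} (s≤s z≤n) (s≤s (ℕP.m≤n+m 1 d))

  flow-bound-one-dimensional : ∀ q a → q ≡ 1 → q * suc (2 * a) ^ 1 * (suc (2 * (q * a)) * q) ≤ (q * suc (2 * a)) ^ (1 * (1 + 1))
  flow-bound-one-dimensional q a refl = ℕP.≤-reflexive (square a)
    where
      square : ∀ a → 1 * ((1 + 2 * a) * 1) * ((1 + 2 * (1 * a)) * 1) ≡ (1 * (1 + 2 * a)) * ((1 * (1 + 2 * a)) * 1)
      square = solve-∀

  kernel-bound-scale : ∀ d q a → 1 ≤ q → kernel-bound d (q * a) ≤ q ^ d * kernel-bound d a
  kernel-bound-scale d q a q≥1 = begin
    suc d * suc (suc d * (q * a)) ^ d       ≤⟨ ℕP.*-monoʳ-≤ (suc d) (ℕP.^-monoˡ-≤ d entry) ⟩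
    suc d * (q * suc (suc d * a)) ^ d       ≡⟨ cong (suc d *_) (*-distrib-^ q (suc (suc d * a)) d) ⟩
    suc d * (q ^ d * suc (suc d * a) ^ d)   ≡⟨ ℕP.*-comm (suc d) _ ⟩
    q ^ d * suc (suc d * a) ^ d * suc d     ≡⟨ ℕP.*-assoc (q ^ d) _ (suc d) ⟩
    q ^ d * (suc (suc d * a) ^ d * suc d)   ≡⟨ cong (q ^ d *_) (ℕP.*-comm _ (suc d)) ⟩
    q ^ d * (suc d * suc (suc d * a) ^ d)   ∎
    where
      entry : suc (suc d * (q * a)) ≤ q * suc (suc d * a)
      entry = begin
        suc (suc d * (q * a))    ≡⟨ cong suc (regroup (suc d) q a) ⟩
        1 + q * (suc d * a)      ≤⟨ ℕP.+-monoˡ-≤ (q * (suc d * a)) q≥1 ⟩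
        q + q * (suc d * a)      ≡⟨ distribute q (suc d * a) ⟩
        q * suc (suc d * a)      ∎
        where
          regroup : ∀ m q a → m * (q * a) ≡ q * (m * a)
          regroup = solve-∀
          distribute : ∀ q x → q + q * x ≡ q * (1 + x)
          distribute = solve-∀

  -- For d = 2 this is a polynomial inequality; for d ≥ 3 already 1 + (d + 1) a ≤ (1 + 2 a) ^ (d - 1).
  power-≤ : ∀ d a → 2 ≤ d → 1 ≤ a → suc (suc d * a) ^ suc d ≤ suc (2 * a) ^ (d * d)
  power-≤ 1 _ (s≤s ()) _
  power-≤ 2 (suc b) _ _ = ℕP.≤-trans (ℕP.m≤m+n _ (17 + 72 * b + 108 * (b * b) + 69 * (b * b * b) + 16 * (b * b * b * b)))
                                      (ℕP.≤-reflexive (expand b))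
    where
      expand : ∀ b → let x = suc (3 * suc b) ; y = suc (2 * suc b) in
        x * (x * (x * 1)) + (17 + 72 * b + 108 * (b * b) + 69 * (b * b * b) + 16 * (b * b * b * b)) ≡ y * (y * (y * (y * 1)))
      expand = solve-∀
  power-≤ (suc (suc (suc e))) a _ a≥1 = begin
    suc (suc d * a) ^ suc d              ≤⟨ ℕP.^-monoˡ-≤ (suc d) entry ⟩
    (suc (2 * a) ^ (2 + e)) ^ suc d      ≡⟨ ℕP.^-*-assoc (suc (2 * a)) (2 + e) (suc d) ⟩
    suc (2 * a) ^ ((2 + e) * suc d)      ≤⟨ power-mono (suc (2 * a)) (s≤s z≤n) (ℕP.≤-trans (ℕP.n≤1+n _) (ℕP.≤-reflexive (square e))) ⟩
    suc (2 * a) ^ (d * d)                ∎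
    where
      d : ℕ
      d = 3 + e
      square : ∀ e → suc ((2 + e) * (4 + e)) ≡ (3 + e) * (3 + e)
      square = solve-∀
      entry : suc (suc d * a) ≤ suc (2 * a) ^ (2 + e)
      entry = ℕP.≤-trans (s≤s (begin
        (4 + e) * a           ≤⟨ ℕP.*-monoˡ-≤ a (ℕP.m≤m+n (4 + e) e) ⟩
        (4 + e + e) * a       ≡⟨ double e a ⟩
        (2 + e) * (2 * a)     ∎)) (bernoulli (2 + e) (2 * a))
        where
          double : ∀ e a → (4 + e + e) * a ≡ (2 + e) * (2 * a)
          double = solve-∀

  kernel-bound-≤ : ∀ d a → 2 ≤ d → 1 ≤ a → kernel-bound d a ≤ suc (2 * a) ^ (d * d)
  kernel-bound-≤ d a 2≤d a≥1 = begin
    suc d * suc (suc d * a) ^ d             ≤⟨ ℕP.*-monoˡ-≤ (suc (suc d * a) ^ d) d+1≤ ⟩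
    suc (suc d * a) * suc (suc d * a) ^ d   ≤⟨ power-≤ d a 2≤d a≥1 ⟩
    suc (2 * a) ^ (d * d)                   ∎
    where
      d+1≤ : suc d ≤ suc (suc d * a)
      d+1≤ = ℕP.≤-trans (ℕP.m≤m*n (suc d) a ⦃ ℕ.>-nonZero a≥1 ⦄) (ℕP.n≤1+n _)

  exponent-≤ : ∀ d → 2 ≤ d → 2 + d ≤ d * (d + 1)
  exponent-≤ 1 (s≤s ())
  exponent-≤ (suc (suc e)) _ = ℕP.≤-trans (ℕP.m≤m+n (2 + (2 + e)) (2 + 4 * e + e * e)) (ℕP.≤-reflexive (expand e))
    where
      expand : ∀ e → 2 + (2 + e) + (2 + 4 * e + e * e) ≡ (2 + e) * ((2 + e) + 1)
      expand = solve-∀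

  flow-bound-general : ∀ d q a → 2 ≤ d → 1 ≤ q → 1 ≤ a →
    q * suc (2 * a) ^ d * (kernel-bound d (q * a) * q) ≤ (q * suc (2 * a)) ^ (d * (d + 1))
  flow-bound-general d q a 2≤d q≥1 a≥1 = begin
    q * Y ^ d * (kernel-bound d (q * a) * q)
      ≤⟨ ℕP.*-monoʳ-≤ (q * Y ^ d) (ℕP.*-monoˡ-≤ q (ℕP.≤-trans (kernel-bound-scale d q a q≥1) (ℕP.*-monoʳ-≤ (q ^ d) (kernel-bound-≤ d a 2≤d a≥1)))) ⟩
    q * Y ^ d * (q ^ d * Y ^ (d * d) * q)
      ≡⟨ regroup q (q ^ d) (Y ^ d) (Y ^ (d * d)) ⟩
    q ^ (2 + d) * (Y ^ d * Y ^ (d * d))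
      ≡⟨ cong (q ^ (2 + d) *_) (ℕP.^-distribˡ-+-* Y d (d * d)) ⟨
    q ^ (2 + d) * Y ^ (d + d * d)
      ≤⟨ ℕP.*-mono-≤ (power-mono q q≥1 (exponent-≤ d 2≤d)) (ℕP.≤-reflexive (cong (Y ^_) (square d))) ⟩
    q ^ (d * (d + 1)) * Y ^ (d * (d + 1))
      ≡⟨ *-distrib-^ q Y (d * (d + 1)) ⟨
    (q * Y) ^ (d * (d + 1))
      ∎
    where
      Y : ℕ
      Y = suc (2 * a)
      regroup : ∀ q qd yd ydd → q * yd * (qd * ydd * q) ≡ q * (q * qd) * (yd * ydd)
      regroup = solve-∀
      square : ∀ d → d + d * d ≡ d * (d + 1)
      square = solve-∀

module Walks where

  open import Defs
  open import Data.Nat as ℕ using (suc; _≤_; s≤s)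
  import Data.Nat.Properties as ℕP
  open import Data.Integer as ℤ using (ℤ; +_; _+_; 0ℤ)
  import Data.Integer.Properties as ℤP
  open import Data.Integer.Tactic.RingSolver using (solve-∀)
  open import Data.Fin using (Fin)
  open import Data.Vec using (lookup)
  import Data.Vec.Properties as VecP
  open import Data.List as List using (List; []; _∷_; _++_; length)
  import Data.List.Properties as ListP
  open import Data.List.Membership.Propositional using (_∈_; _∉_)
  import Data.List.Membership.Propositional.Properties as ∈P
  open import Data.List.Relation.Unary.Any using (Any; here; there)
  open import Data.List.Relation.Unary.All as All using (All; []; _∷_)
  open import Data.List.Relation.Unary.AllPairs using ([]; _∷_)
  open import Data.List.Relation.Unary.Unique.Propositional using (Unique)
  open import Data.List.Relation.Binary.Subset.Propositional using (_⊆_)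
  open import Data.Product using (Σ; _×_; _,_)
  open import Data.Sum using (_⊎_; inj₁; inj₂; [_,_]′) renaming (map₁ to ⊎-map₁)
  open import Relation.Nullary using (yes; no; contradiction)
  open import Relation.Binary.PropositionalEquality
  open Counting using (length-≤-of-injective)
  open Sums using (sumℤ)

  data Walk {d} : State d → List (Transition d) → State d → Set where
    [] : ∀ {x} → Walk x [] x
    step : ∀ {x t ts y} → src t ≡ x → Walk (tgt t) ts y → Walk x (t ∷ ts) y

  Closed : ∀ {d} → List (Transition d) → Set
  Closed {d} ts = Σ (State d) λ s → Walk s ts s

  states : ∀ {d} → State d → List (Transition d) → List (State d)
  states x ts = x ∷ List.map tgt ts

  labelSum : ∀ {d} → List (Transition d) → Fin d → ℤ
  labelSum ts i = sumℤ (List.map (λ t → lookup (lbl t) i) ts)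

  labelSum-++ : ∀ {d} (ts us : List (Transition d)) i → labelSum (ts ++ us) i ≡ labelSum ts i + labelSum us i
  labelSum-++ [] us i = sym (ℤP.+-identityˡ _)
  labelSum-++ (t ∷ ts) us i = trans (cong (_+_ (lookup (lbl t) i)) (labelSum-++ ts us i)) (sym (ℤP.+-assoc (lookup (lbl t) i) (labelSum ts i) (labelSum us i)))

  lookup-Δ : ∀ {d} (a : ℤVec d) σ i → lookup (Δ (a ∷ σ)) i ≡ lookup a i + lookup (Δ σ) i
  lookup-Δ a σ i = VecP.lookup-zipWith _+_ i a (Δ σ)

  walk-of-path : ∀ {d} {T : List (Transition d)} {x σ y} → Path T x σ y →
    Σ (List (Transition d)) λ ts → Walk x ts y × All (_∈ T) ts × (∀ i → labelSum ts i ≡ lookup (Δ σ) i)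
  walk-of-path nil = [] , [] , [] , λ i → sym (VecP.lookup-replicate i (+ 0))
  walk-of-path (cons {x} {a} {y} {σ} t∈T p) with walk-of-path p
  ... | ts , walk , ts⊆T , same = (x , a , y) ∷ ts , step refl walk , t∈T ∷ ts⊆T ,
    λ i → trans (cong (_+_ (lookup a i)) (same i)) (sym (lookup-Δ a σ i))

  -- Going along t and back along the reverse path closes a walk of displacement 0.
  closed-walk-through : ∀ {d} (T : List (Transition d)) → Reversible T → ∀ {t} → t ∈ T →
    Σ (List (Transition d)) λ W → Walk (src t) W (src t) × All (_∈ T) W × t ∈ W × (∀ i → labelSum W i ≡ 0ℤ)
  closed-walk-through {d} T reversible {x , a , y} t∈T with reversible x y (a ∷ []) (cons t∈T nil)
  ... | σ , back , Δ≡0 with walk-of-path back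
  ... | ts , walk , ts⊆T , same = (x , a , y) ∷ ts , step refl walk , t∈T ∷ ts⊆T , here refl , λ i → begin
    lookup a i + labelSum ts i                      ≡⟨ cong (_+_ (lookup a i)) (same i) ⟩
    lookup a i + lookup (Δ σ) i                     ≡⟨ cong (_+ lookup (Δ σ) i) (ℤP.+-identityʳ (lookup a i)) ⟨
    lookup a i + 0ℤ + lookup (Δ σ) i                ≡⟨ cong (λ s → lookup a i + s + lookup (Δ σ) i) (VecP.lookup-replicate i (+ 0)) ⟨
    lookup a i + lookup (Δ []) i + lookup (Δ σ) i   ≡⟨ cong (_+ lookup (Δ σ) i) (lookup-Δ a [] i) ⟨
    lookup (Δ (a ∷ [])) i + lookup (Δ σ) i          ≡⟨ VecP.lookup-zipWith _+_ i (Δ (a ∷ [])) (Δ σ) ⟨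
    lookup (Δ (a ∷ []) ⊕ Δ σ) i                     ≡⟨ cong (λ v → lookup v i) Δ≡0 ⟩
    lookup (zeroVec d) i                            ≡⟨ VecP.lookup-replicate i (+ 0) ⟩
    0ℤ                                              ∎
    where open ≡-Reasoning

  unique-suffix : ∀ {A : Set} (xs ys : List A) → Unique (xs ++ ys) → Unique ys
  unique-suffix [] ys u = u
  unique-suffix (_ ∷ xs) ys (_ ∷ u) = unique-suffix xs ys u

  final-state-visited : ∀ {d} {x y : State d} {t ts} → Walk x (t ∷ ts) y → y ∈ List.map tgt (t ∷ ts)
  final-state-visited (step _ []) = here refl
  final-state-visited {y = y} (step {t = t} _ (step {t = t′} {ts = ts} e walk)) = there (final-state-visited {x = tgt t} {y} {t′} {ts} (step e walk))

  split-at-state : ∀ {d} {x₁ y : State d} {ts} x → Walk x₁ ts y → x ∈ states x₁ ts →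
    Σ (List (Transition d)) λ pre → Σ (List (Transition d)) λ post →
      ts ≡ pre ++ post × Walk x₁ pre x × Walk x post y × Σ (List (State d)) λ zs → states x₁ ts ≡ zs ++ states x post
  split-at-state x walk (here refl) = [] , _ , refl , [] , walk , [] , refl
  split-at-state {x₁ = x₁} x (step {t = t} e walk) (there x∈) with split-at-state x walk x∈
  ... | pre , post , refl , pre-walk , post-walk , zs , eq = t ∷ pre , post , refl , step e pre-walk , post-walk , x₁ ∷ zs , cong (x₁ ∷_) eq

  module _ {d} (Q : List (State d)) where

    open import Data.List.Membership.DecPropositional (_≟S_ {d}) using (_∈?_)

    simple-length : ∀ {x} ts → Unique (states x ts) → All (_∈ Q) (states x ts) → suc (length ts) ≤ length Q
    simple-length {x} ts simple in-Q = subst (λ m → suc m ≤ length Q) (ListP.length-map tgt ts)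
      (length-≤-of-injective (λ s → s) (states x ts) Q simple in-Q (λ _ _ eq → eq))

    record SimplePathAndCycles (x : State d) (W : List (Transition d)) (y : State d) : Set where
      field
        path : List (Transition d)
        path-walk : Walk x path y
        path-simple : Unique (states x path)
        path⊆W : path ⊆ W
        cycles : List (List (Transition d))
        cycles-closed : All Closed cycles
        cycles-short : All (λ C → length C ≤ length Q) cycles
        cycles⊆W : All (_⊆ W) cycles
        covers : ∀ {e} → e ∈ W → e ∈ path ⊎ Any (e ∈_) cycles
        labelSum-split : ∀ i → labelSum W i ≡ labelSum path i + sumℤ (List.map (λ C → labelSum C i) cycles)

    private
      TargetsIn : List (Transition d) → Set
      TargetsIn W = ∀ {e} → e ∈ W → tgt e ∈ Q

      states-in : ∀ {x} ts → x ∈ Q → TargetsIn ts → All (_∈ Q) (states x ts)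
      states-in ts x∈Q tgt∈Q = x∈Q ∷ All.tabulate λ s∈ → let e , e∈ , s≡ = ∈P.∈-map⁻ tgt s∈ in subst (_∈ Q) (sym s≡) (tgt∈Q e∈)

    module _ {x t W y} (e : src t ≡ x) (rest : SimplePathAndCycles (tgt t) W y) where
      open SimplePathAndCycles rest

      extend-path : x ∉ states (tgt t) path → SimplePathAndCycles x (t ∷ W) y
      extend-path x∉path = record
        { path = t ∷ path
        ; path-walk = step e path-walk
        ; path-simple = All.tabulate (λ s∈ x≡s → x∉path (subst (_∈ _) (sym x≡s) s∈)) ∷ path-simple
        ; path⊆W = λ { (here refl) → here refl ; (there e∈) → there (path⊆W e∈) }
        ; cycles = cycles
        ; cycles-closed = cycles-closed
        ; cycles-short = cycles-short
        ; cycles⊆W = All.map (λ C⊆W {_} e∈ → there (C⊆W e∈)) cycles⊆W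
        ; covers = λ { (here refl) → inj₁ (here refl) ; (there e∈) → ⊎-map₁ there (covers e∈) }
        ; labelSum-split = λ i → trans (cong (_+_ (lookup (lbl t) i)) (labelSum-split i)) (sym (ℤP.+-assoc (lookup (lbl t) i) (labelSum path i) _)) }

      close-cycle : x ∈ states (tgt t) path → All (_∈ Q) (states (tgt t) path) → SimplePathAndCycles x (t ∷ W) y
      close-cycle x∈path path-in-Q with split-at-state x path-walk x∈path
      ... | pre , post , path≡ , pre-walk , post-walk , zs , states≡ = record
        { path = post
        ; path-walk = post-walk
        ; path-simple = unique-suffix zs (states x post) (subst Unique states≡ path-simple)
        ; path⊆W = λ e∈ → there (path⊆W (subst (_ ∈_) (sym path≡) (∈P.∈-++⁺ʳ pre e∈)))
        ; cycles = (t ∷ pre) ∷ cycles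
        ; cycles-closed = (x , step e pre-walk) ∷ cycles-closed
        ; cycles-short = short ∷ cycles-short
        ; cycles⊆W = (λ { (here refl) → here refl ; (there e∈) → there (path⊆W (subst (_ ∈_) (sym path≡) (∈P.∈-++⁺ˡ e∈))) })
                     ∷ All.map (λ C⊆W {_} e∈ → there (C⊆W e∈)) cycles⊆W
        ; covers = λ { (here refl) → inj₂ (here (here refl)) ; (there e∈) → cover e∈ }
        ; labelSum-split = split }
        where
          short : length (t ∷ pre) ≤ length Q
          short = ℕP.≤-trans (s≤s (subst (length pre ≤_) (cong length (sym path≡)) (ListP.length-++-≤ˡ pre)))
                             (simple-length path path-simple path-in-Q)
          cover : ∀ {e} → e ∈ W → e ∈ post ⊎ Any (e ∈_) ((t ∷ pre) ∷ cycles)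
          cover e∈ with covers e∈
          ... | inj₂ in-cycle = inj₂ (there in-cycle)
          ... | inj₁ e∈path with ∈P.∈-++⁻ pre (subst (_ ∈_) path≡ e∈path)
          ...   | inj₁ e∈pre = inj₂ (here (there e∈pre))
          ...   | inj₂ e∈post = inj₁ e∈post
          split : ∀ i → lookup (lbl t) i + labelSum W i ≡ labelSum post i + sumℤ (List.map (λ C → labelSum C i) ((t ∷ pre) ∷ cycles))
          split i = begin
            a + labelSum W i                              ≡⟨ cong (_+_ a) (labelSum-split i) ⟩
            a + (labelSum path i + S)                     ≡⟨ cong (λ p → a + (p + S)) (trans (cong (λ ts → labelSum ts i) path≡) (labelSum-++ pre post i)) ⟩
            a + (labelSum pre i + labelSum post i + S)    ≡⟨ rearrange a (labelSum pre i) (labelSum post i) S ⟩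
            labelSum post i + (a + labelSum pre i + S)    ∎
            where
              open ≡-Reasoning
              a S : ℤ
              a = lookup (lbl t) i
              S = sumℤ (List.map (λ C → labelSum C i) cycles)
              rearrange : ∀ a b c s → a + (b + c + s) ≡ c + (a + b + s)
              rearrange = solve-∀

    decompose : ∀ {x W y} → Walk x W y → TargetsIn W → SimplePathAndCycles x W y
    decompose [] _ = record
      { path = [] ; path-walk = [] ; path-simple = [] ∷ [] ; path⊆W = λ ()
      ; cycles = [] ; cycles-closed = [] ; cycles-short = [] ; cycles⊆W = []
      ; covers = λ () ; labelSum-split = λ _ → refl }
    decompose {x} (step {t = t} e walk) tgt∈Q with decompose walk (λ e∈ → tgt∈Q (there e∈))
    ... | rest with x ∈? states (tgt t) (SimplePathAndCycles.path rest)
    ...   | no x∉path = extend-path e rest x∉path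
    ...   | yes x∈path = close-cycle e rest x∈path
            (states-in (SimplePathAndCycles.path rest) (tgt∈Q (here refl)) (λ e∈ → tgt∈Q (there (SimplePathAndCycles.path⊆W rest e∈))))

    record CycleDecomposition (W : List (Transition d)) : Set where
      field
        cycles : List (List (Transition d))
        cycles-closed : All Closed cycles
        cycles-short : All (λ C → length C ≤ length Q) cycles
        cycles⊆W : All (_⊆ W) cycles
        covers : ∀ {e} → e ∈ W → Any (e ∈_) cycles
        labelSum-split : ∀ i → labelSum W i ≡ sumℤ (List.map (λ C → labelSum C i) cycles)

    -- The simple path left over by a closed walk is empty: it would revisit its start.
    decompose-closed : ∀ {x W} → Walk x W x → TargetsIn W → CycleDecomposition W
    decompose-closed walk tgt∈Q with decompose walk tgt∈Q
    ... | rest with SimplePathAndCycles.path rest | SimplePathAndCycles.path-walk rest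
                  | SimplePathAndCycles.path-simple rest | SimplePathAndCycles.covers rest | SimplePathAndCycles.labelSum-split rest
    ... | [] | _ | _ | covers | split = record
      { cycles = cycles ; cycles-closed = cycles-closed ; cycles-short = cycles-short ; cycles⊆W = cycles⊆W
      ; covers = λ e∈ → [ (λ ()) , (λ in-cycle → in-cycle) ]′ (covers e∈)
      ; labelSum-split = λ i → trans (split i) (ℤP.+-identityˡ _) }
      where open SimplePathAndCycles rest using (cycles; cycles-closed; cycles-short; cycles⊆W)
    ... | _ ∷ _ | path-walk | x∉later ∷ _ | _ | _ = contradiction refl (All.lookup x∉later (final-state-visited path-walk))

module Flows where

  open import Defs
  open import Data.Nat as ℕ using (ℕ; zero; suc; _≤_; z≤n; s≤s)
  import Data.Nat.Properties as ℕP
  open import Data.Nat.ListAction using (sum)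
  open import Data.Integer as ℤ using (ℤ; +_; _+_; _*_; 0ℤ)
  import Data.Integer.Properties as ℤP
  open import Algebra.Properties.AbelianGroup ℤP.+-0-abelianGroup using (∙-cancelˡ)
  open import Data.Fin using (Fin; zero; suc)
  open import Data.Bool using (Bool; true; false; if_then_else_)
  open import Data.Vec as Vec using (lookup)
  import Data.Vec.Properties as VecP
  open import Data.Vec.Relation.Binary.Pointwise.Extensional using (ext; Pointwise-≡⇒≡)
  open import Data.List as List using (List; []; _∷_; length)
  open import Data.List.Membership.Propositional using (_∈_; _∉_)
  open import Data.List.Relation.Unary.Any using (here; there; index)
  open import Data.List.Relation.Unary.Any.Properties using (lookup-index)
  open import Data.List.Membership.Propositional.Properties using (∈-lookup)
  open import Data.List.Relation.Unary.All as All using (All; []; _∷_)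
  open import Data.List.Relation.Unary.AllPairs using (_∷_)
  open import Data.List.Relation.Unary.Unique.Propositional using (Unique)
  import Data.Product.Properties as ProductP
  open import Data.Product using (Σ; _×_; _,_)
  open import Relation.Nullary using (yes; no; contradiction)
  open import Relation.Nullary.Decidable using (⌊_⌋)
  open import Relation.Binary.Definitions using (DecidableEquality)
  open import Relation.Binary.PropositionalEquality
  open Sums
  open Walks
  open Kernel using (comb; toℤ)
  open KernelVectors using (BoundedKernelVector)

  _≟T_ : ∀ {d} → DecidableEquality (Transition d)
  _≟T_ = ProductP.≡-dec _≟S_ (ProductP.≡-dec (VecP.≡-dec ℤ._≟_) _≟S_)

  indicator : Bool → ℤ
  indicator b = if b then + 1 else 0ℤ

  multiplicity : ∀ {d} → Transition d → List (Transition d) → ℕ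
  multiplicity e [] = 0
  multiplicity e (t ∷ ts) = (if ⌊ t ≟T e ⌋ then 1 else 0) ℕ.+ multiplicity e ts

  multiplicity-≤-length : ∀ {d} (e : Transition d) ts → multiplicity e ts ≤ length ts
  multiplicity-≤-length e [] = z≤n
  multiplicity-≤-length e (t ∷ ts) with ⌊ t ≟T e ⌋
  ... | true = s≤s (multiplicity-≤-length e ts)
  ... | false = ℕP.m≤n⇒m≤1+n (multiplicity-≤-length e ts)

  multiplicity-≥-1 : ∀ {d} {e : Transition d} {ts} → e ∈ ts → 1 ≤ multiplicity e ts
  multiplicity-≥-1 {e = e} (here refl) with e ≟T e
  ... | yes _ = s≤s z≤n
  ... | no e≢e = contradiction refl e≢e
  multiplicity-≥-1 {ts = t ∷ _} (there e∈) = ℕP.≤-trans (multiplicity-≥-1 e∈) (ℕP.m≤n+m _ _)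

  enters leaves : ∀ {d} → State d → Transition d → ℤ
  enters x t = indicator ⌊ tgt t ≟S x ⌋
  leaves x t = indicator ⌊ src t ≟S x ⌋

  walk-balance : ∀ {d} (x : State d) {s C y} → Walk s C y →
    indicator ⌊ s ≟S x ⌋ + sumℤ (List.map (enters x) C) ≡ sumℤ (List.map (leaves x) C) + indicator ⌊ y ≟S x ⌋
  walk-balance x {s} [] = trans (ℤP.+-identityʳ (indicator ⌊ s ≟S x ⌋)) (sym (ℤP.+-identityˡ (indicator ⌊ s ≟S x ⌋)))
  walk-balance x {y = y} (step {t = t} {ts = C} refl walk) = begin
    leaves x t + (enters x t + sumℤ (List.map (enters x) C))          ≡⟨ cong (_+_ (leaves x t)) (walk-balance x walk) ⟩
    leaves x t + (sumℤ (List.map (leaves x) C) + indicator ⌊ y ≟S x ⌋) ≡⟨ ℤP.+-assoc (leaves x t) (sumℤ (List.map (leaves x) C)) (indicator ⌊ y ≟S x ⌋) ⟨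
    leaves x t + sumℤ (List.map (leaves x) C) + indicator ⌊ y ≟S x ⌋   ∎
    where open ≡-Reasoning

  closed-walk-balance : ∀ {d} (x : State d) {C} → Closed C → sumℤ (List.map (enters x) C) ≡ sumℤ (List.map (leaves x) C)
  closed-walk-balance x {C} (s , walk) = ∙-cancelˡ (indicator ⌊ s ≟S x ⌋) _ _
    (trans (walk-balance x walk) (ℤP.+-comm (sumℤ (List.map (leaves x) C)) _))

  module _ {d} (T : List (Transition d)) where

    ∫ : (Transition d → ℕ) → (Transition d → ℤ) → ℤ
    ∫ μ f = sumℤ (List.map (λ t → + μ t * f t) T)

    ∫-+ : ∀ μ ν f → ∫ (λ t → μ t ℕ.+ ν t) f ≡ ∫ μ f + ∫ ν f
    ∫-+ μ ν f = trans (sumℤ-map-cong T (λ t → trans (cong (_* f t) (ℤP.pos-+ (μ t) (ν t))) (ℤP.*-distribʳ-+ (f t) (+ μ t) (+ ν t))))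
                      (sumℤ-map-+ (λ t → + μ t * f t) (λ t → + ν t * f t) T)

    ∫-scale : ∀ k μ f → ∫ (λ t → k ℕ.* μ t) f ≡ + k * ∫ μ f
    ∫-scale k μ f = trans (sumℤ-map-cong T (λ t → trans (cong (_* f t) (ℤP.pos-* k (μ t))) (ℤP.*-assoc (+ k) (+ μ t) (f t))))
                          (sumℤ-map-scale (+ k) (λ t → + μ t * f t) T)

    ∫-zero : ∀ f → ∫ (λ _ → 0) f ≡ 0ℤ
    ∫-zero f = trans (sumℤ-map-cong T (λ t → ℤP.*-zeroˡ (f t))) (sumℤ-map-zero T)

    ∫-∑ : ∀ {n} (μ : Fin n → Transition d → ℕ) f → ∫ (λ t → ∑ℕ (λ j → μ j t)) f ≡ ∑ (λ j → ∫ (μ j) f)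
    ∫-∑ {zero} μ f = ∫-zero f
    ∫-∑ {suc n} μ f = trans (∫-+ (μ zero) (λ t → ∑ℕ (λ j → μ (suc j) t)) f) (cong (_+_ (∫ (μ zero) f)) (∫-∑ (λ j → μ (suc j)) f))

    private
      ∫-point-absent : ∀ ts e (f : Transition d → ℤ) → e ∉ ts →
        sumℤ (List.map (λ t → + (if ⌊ e ≟T t ⌋ then 1 else 0) * f t) ts) ≡ 0ℤ
      ∫-point-absent [] e f _ = refl
      ∫-point-absent (t ∷ ts) e f e∉ with e ≟T t
      ... | yes e≡t = contradiction (here e≡t) e∉
      ... | no _ = trans (ℤP.+-identityˡ _) (∫-point-absent ts e f (λ e∈ → e∉ (there e∈)))

      ∫-point : ∀ ts e (f : Transition d → ℤ) → Unique ts → e ∈ ts →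
        sumℤ (List.map (λ t → + (if ⌊ e ≟T t ⌋ then 1 else 0) * f t) ts) ≡ f e
      ∫-point (t ∷ ts) e f (t∉ts ∷ _) (here refl) with e ≟T e
      ... | no e≢e = contradiction refl e≢e
      ... | yes _ = trans (cong (_+_ (+ 1 * f e)) (∫-point-absent ts e f (λ e∈ → All.lookup t∉ts e∈ refl)))
                          (trans (ℤP.+-identityʳ _) (ℤP.*-identityˡ (f e)))
      ∫-point (t ∷ ts) e f (t∉ts ∷ ts-unique) (there e∈) with e ≟T t
      ... | yes refl = contradiction refl (All.lookup t∉ts e∈)
      ... | no _ = trans (ℤP.+-identityˡ _) (∫-point ts e f ts-unique e∈)

    ∫-multiplicity : Unique T → ∀ C → All (_∈ T) C → ∀ f → ∫ (λ t → multiplicity t C) f ≡ sumℤ (List.map f C)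
    ∫-multiplicity T-unique [] [] f = ∫-zero f
    ∫-multiplicity T-unique (e ∷ C) (e∈T ∷ C⊆T) f = begin
      ∫ (λ t → (if ⌊ e ≟T t ⌋ then 1 else 0) ℕ.+ multiplicity t C) f
        ≡⟨ ∫-+ (λ t → if ⌊ e ≟T t ⌋ then 1 else 0) (λ t → multiplicity t C) f ⟩
      ∫ (λ t → if ⌊ e ≟T t ⌋ then 1 else 0) f + ∫ (λ t → multiplicity t C) f
        ≡⟨ cong₂ _+_ (∫-point T e f T-unique e∈T) (∫-multiplicity T-unique C C⊆T f) ⟩
      f e + sumℤ (List.map f C) ∎
      where open ≡-Reasoning

    ∫-indicator : ∀ μ (selected : Transition d → Bool) →
      + sum (List.map (λ t → if selected t then μ t else 0) T) ≡ ∫ μ (λ t → indicator (selected t))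
    ∫-indicator μ selected = go T
      where
        go : ∀ ts → + sum (List.map (λ t → if selected t then μ t else 0) ts) ≡ sumℤ (List.map (λ t → + μ t * indicator (selected t)) ts)
        go [] = refl
        go (t ∷ ts) = trans (ℤP.pos-+ (if selected t then μ t else 0) _) (cong₂ _+_ (term t) (go ts))
          where
            term : ∀ t → + (if selected t then μ t else 0) ≡ + μ t * indicator (selected t)
            term t with selected t
            ... | true = sym (ℤP.*-identityʳ (+ μ t))
            ... | false = sym (ℤP.*-zeroʳ (+ μ t))

    lookup-displacement : ∀ μ i → lookup (displacement T μ) i ≡ ∫ μ (λ t → lookup (lbl t) i)
    lookup-displacement μ i = go T
      where
        go : ∀ ts → lookup (displacement ts μ) i ≡ sumℤ (List.map (λ t → + μ t * lookup (lbl t) i) ts)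
        go [] = VecP.lookup-replicate i (+ 0)
        go (t ∷ ts) = trans (VecP.lookup-zipWith _+_ i (Vec.map (+ μ t *_) (lbl t)) (displacement ts μ))
                            (cong₂ _+_ (VecP.lookup-map i (+ μ t *_) (lbl t)) (go ts))

  cycle-matrix : ∀ {d} (Cs : List (List (Transition d))) → Fin (length Cs) → Fin d → ℤ
  cycle-matrix Cs j i = labelSum (List.lookup Cs j) i

  module _ {d} (Q : List (State d)) (T : List (Transition d)) where

    Balanced : (Transition d → ℕ) → Set
    Balanced μ = ∀ x → x ∈ Q → ∫ T μ (enters x) ≡ ∫ T μ (leaves x)

    balanced-kirchhoff : ∀ {μ} → Balanced μ → IsKirchhoff Q T μ
    balanced-kirchhoff {μ} balanced x x∈Q = ℤP.+-injective (begin
      + inSum T μ x          ≡⟨ ∫-indicator T μ (λ t → ⌊ tgt t ≟S x ⌋) ⟩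
      ∫ T μ (enters x)       ≡⟨ balanced x x∈Q ⟩
      ∫ T μ (leaves x)       ≡⟨ ∫-indicator T μ (λ t → ⌊ src t ≟S x ⌋) ⟨
      + outSum T μ x         ∎)
      where open ≡-Reasoning

    balanced-scale : ∀ k {μ} → Balanced μ → Balanced (λ t → k ℕ.* μ t)
    balanced-scale k {μ} balanced x x∈Q =
      trans (∫-scale T k μ (enters x)) (trans (cong (+ k *_) (balanced x x∈Q)) (sym (∫-scale T k μ (leaves x))))

    balanced-∑ : ∀ {n} (μ : Fin n → Transition d → ℕ) → (∀ j → Balanced (μ j)) → Balanced (λ t → ∑ℕ (λ j → μ j t))
    balanced-∑ μ balanced x x∈Q =
      trans (∫-∑ T μ (enters x)) (trans (∑-cong (λ j → balanced j x x∈Q)) (sym (∫-∑ T μ (leaves x))))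

    cycle-balanced : Unique T → ∀ {C} → Closed C → All (_∈ T) C → Balanced (λ t → multiplicity t C)
    cycle-balanced T-unique {C} closed C⊆T x _ =
      trans (∫-multiplicity T T-unique C C⊆T (enters x))
            (trans (closed-walk-balance x closed) (sym (∫-multiplicity T T-unique C C⊆T (leaves x))))

    record FlowThrough (t : Transition d) (B : ℕ) : Set where
      field
        flow : Transition d → ℕ
        balanced : Balanced flow
        no-displacement : ∀ i → ∫ T flow (λ e → lookup (lbl e) i) ≡ 0ℤ
        through : 1 ≤ flow t
        bounded : ∀ e → flow e ≤ B

    combine-flows : ∀ B → (∀ {t} → t ∈ T → FlowThrough t B) →
      Σ (Transition d → ℕ) λ μ →
        IsKirchhoff Q T μ × IsTotal T μ × displacement T μ ≡ zeroVec d × NormBounded T μ (length T ℕ.* B)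
    combine-flows B flows = μ , balanced-kirchhoff (balanced-∑ flow-at (λ j → balanced (flows (∈-lookup j)))) , total ,
                            no-total-displacement , λ e _ → ℕP.≤-trans (∑ℕ-mono-≤ (λ j → bounded (flows (∈-lookup j)) e)) (ℕP.≤-reflexive (∑ℕ-const (length T) B))
      where
        open FlowThrough
        flow-at : Fin (length T) → Transition d → ℕ
        flow-at j = flow (flows (∈-lookup j))
        μ : Transition d → ℕ
        μ e = ∑ℕ (λ j → flow-at j e)
        total : IsTotal T μ
        total t t∈T = ℕP.≤-trans (subst (λ e → 1 ≤ flow-at (index t∈T) e) (sym (lookup-index t∈T)) (through (flows (∈-lookup (index t∈T)))))
                                 (term≤∑ℕ (λ j → flow-at j t) (index t∈T))
        no-total-displacement : displacement T μ ≡ zeroVec d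
        no-total-displacement = Pointwise-≡⇒≡ (ext λ i → begin
          lookup (displacement T μ) i                   ≡⟨ lookup-displacement T μ i ⟩
          ∫ T μ (λ e → lookup (lbl e) i)                ≡⟨ ∫-∑ T flow-at (λ e → lookup (lbl e) i) ⟩
          ∑ (λ j → ∫ T (flow-at j) (λ e → lookup (lbl e) i)) ≡⟨ ∑-cong (λ j → no-displacement (flows (∈-lookup j)) i) ⟩
          ∑ {length T} (λ _ → 0ℤ)                        ≡⟨ ∑-zero (length T) ⟩
          0ℤ                                            ≡⟨ VecP.lookup-replicate i (+ 0) ⟨
          lookup (zeroVec d) i                          ∎)
          where open ≡-Reasoning

    flow-from-cycles : Unique T → ∀ {t} q Z (Cs : List (List (Transition d))) → All Closed Cs → All (All (_∈ T)) Cs →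
      All (λ C → length C ≤ q) Cs → ∀ j₁ → t ∈ List.lookup Cs j₁ → BoundedKernelVector (cycle-matrix Cs) j₁ Z →
      FlowThrough t (Z ℕ.* q)
    flow-from-cycles T-unique {t} q Z Cs closed Cs⊆T short j₁ t∈C v = record
      { flow = flow
      ; balanced = balanced-∑ weighted (λ j → balanced-scale (coeff j) (cycle-balanced T-unique (cycle-closed j) (cycle⊆T j)))
      ; no-displacement = no-displacement
      ; through = ℕP.≤-trans (ℕP.*-mono-≤ positive (multiplicity-≥-1 t∈C)) (term≤∑ℕ (λ j → weighted j t) j₁)
      ; bounded = bounded }
      where
        open BoundedKernelVector v
        cycle : Fin (length Cs) → List (Transition d)
        cycle = List.lookup Cs
        cycle-closed : ∀ j → Closed (cycle j)
        cycle-closed j = All.lookup closed (∈-lookup j)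
        cycle⊆T : ∀ j → All (_∈ T) (cycle j)
        cycle⊆T j = All.lookup Cs⊆T (∈-lookup j)
        weighted : Fin (length Cs) → Transition d → ℕ
        weighted j e = coeff j ℕ.* multiplicity e (cycle j)
        flow : Transition d → ℕ
        flow e = ∑ℕ (λ j → weighted j e)
        no-displacement : ∀ i → ∫ T flow (λ e → lookup (lbl e) i) ≡ 0ℤ
        no-displacement i = begin
          ∫ T flow (λ e → lookup (lbl e) i)                   ≡⟨ ∫-∑ T weighted (λ e → lookup (lbl e) i) ⟩
          ∑ (λ j → ∫ T (weighted j) (λ e → lookup (lbl e) i)) ≡⟨ ∑-cong cycle-term ⟩
          comb (cycle-matrix Cs) (toℤ coeff) i                ≡⟨ kernel i ⟩
          0ℤ                                                  ∎
          where
            open ≡-Reasoning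
            cycle-term : ∀ j → ∫ T (weighted j) (λ e → lookup (lbl e) i) ≡ + coeff j * labelSum (cycle j) i
            cycle-term j = trans (∫-scale T (coeff j) (λ e → multiplicity e (cycle j)) (λ e → lookup (lbl e) i))
                                 (cong (+ coeff j *_) (∫-multiplicity T T-unique (cycle j) (cycle⊆T j) (λ e → lookup (lbl e) i)))
        bounded : ∀ e → flow e ≤ Z ℕ.* q
        bounded e = begin
          ∑ℕ (λ j → coeff j ℕ.* multiplicity e (cycle j))  ≤⟨ ∑ℕ-mono-≤ (λ j → ℕP.*-monoʳ-≤ (coeff j) (short-multiplicity j)) ⟩
          ∑ℕ (λ j → coeff j ℕ.* q)                         ≡⟨ ℕΣ.*-distribʳ-sum q coeff ⟨
          ∑ℕ coeff ℕ.* q                                    ≤⟨ ℕP.*-monoˡ-≤ q sum≤ ⟩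
          Z ℕ.* q                                          ∎
          where
            open ℕP.≤-Reasoning
            short-multiplicity : ∀ j → multiplicity e (cycle j) ≤ q
            short-multiplicity j = ℕP.≤-trans (multiplicity-≤-length e (cycle j)) (All.lookup short (∈-lookup j))

module WitnessGraphs where

  open import Defs
  open import Data.Nat as ℕ using (ℕ; zero; suc; _≤_; _∸_; _^_; z≤n; s≤s)
  import Data.Nat.Properties as ℕP
  open import Data.Integer as ℤ using (ℤ; +_; -[1+_]; _+_; 0ℤ; ∣_∣)
  import Data.Integer.Properties as ℤP
  open import Algebra.Properties.AbelianGroup ℤP.+-0-abelianGroup using (∙-cancelˡ)
  open import Data.Fin using (Fin; zero; suc)
  open import Data.Fin.Subset as Subset using (Subset)
  import Data.Fin.Subset.Properties as SubsetP
  open import Data.Vec as Vec using (Vec; []; _∷_; lookup)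
  import Data.Vec.Properties as VecP
  open import Data.Vec.Relation.Binary.Pointwise.Extensional using (ext; Pointwise-≡⇒≡)
  open import Data.Maybe using (just; nothing)
  import Data.Maybe.Properties as MaybeP
  open import Data.List as List using (List; []; _∷_; length)
  open import Data.List.Membership.Propositional using (_∈_)
  import Data.List.Membership.Propositional.Properties as ∈P
  open import Data.List.Relation.Unary.Any using (here; there; index)
  open import Data.List.Relation.Unary.Any.Properties using (lookup-index)
  open import Data.List.Relation.Unary.All as All using (All; []; _∷_)
  import Data.Product.Properties as ProductP
  open import Data.Product using (Σ; _×_; _,_; proj₁; proj₂)
  open import Relation.Nullary using (yes; no; contradiction)
  open import Relation.Binary.PropositionalEquality
  open import Function using (_∘_)
  open Sums
  open Counting
  open Kernel using (comb; InKernel)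
  open KernelVectors using (BoundedKernelVector; kernel-bound; bounded-kernel-vector; trivial-kernel-vector)
  open Walks
  open Flows

  normVec-bound : ∀ {d} (v : ℤVec d) i → ∣ lookup v i ∣ ≤ normVec v
  normVec-bound (x ∷ v) zero = ℕP.m≤m⊔n _ _
  normVec-bound (x ∷ v) (suc i) = ℕP.≤-trans (normVec-bound v i) (ℕP.m≤n⊔m _ _)

  normA-bound : ∀ {d} (A : List (ℤVec d)) {v} → v ∈ A → normVec v ≤ normA A
  normA-bound (w ∷ A) (here refl) = ℕP.m≤m⊔n _ _
  normA-bound (w ∷ A) (there v∈A) = ℕP.≤-trans (normA-bound A v∈A) (ℕP.m≤n⊔m _ _)

  -- z ↦ z + a maps [-a, a] injectively into [0, 2a].
  encode : ℕ → ℤ → ℕ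
  encode a (+ m) = m ℕ.+ a
  encode a -[1+ m ] = a ∸ suc m

  encode-≤ : ∀ a z → ∣ z ∣ ≤ a → encode a z ≤ 2 ℕ.* a
  encode-≤ a (+ m) m≤a = ℕP.≤-trans (ℕP.+-monoˡ-≤ a m≤a) (ℕP.≤-reflexive (cong (a ℕ.+_) (sym (ℕP.+-identityʳ a))))
  encode-≤ a -[1+ m ] _ = ℕP.≤-trans (ℕP.m∸n≤m a (suc m)) (ℕP.m≤m+n a _)

  encode-injective : ∀ a z w → ∣ z ∣ ≤ a → ∣ w ∣ ≤ a → encode a z ≡ encode a w → z ≡ w
  encode-injective a (+ m) (+ n) _ _ eq = cong +_ (ℕP.+-cancelʳ-≡ a m n eq)
  encode-injective a (+ m) -[1+ n ] _ n<a eq = contradiction eq (ℕP.<⇒≢ (ℕP.<-≤-trans (ℕP.∸-monoʳ-< (s≤s z≤n) n<a) (ℕP.m≤n+m a m)) ∘ sym)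
  encode-injective a -[1+ m ] (+ n) m<a _ eq = contradiction eq (ℕP.<⇒≢ (ℕP.<-≤-trans (ℕP.∸-monoʳ-< (s≤s z≤n) m<a) (ℕP.m≤n+m a n)))
  encode-injective a -[1+ m ] -[1+ n ] m<a n<a eq =
    cong -[1+_] (ℕP.suc-injective (ℕP.∸-cancelˡ-≡ m<a n<a eq))

  nonempty-length : ∀ {B : Set} (xs : List B) → xs ≢ [] → 1 ≤ length xs
  nonempty-length [] xs≢[] = contradiction refl xs≢[]
  nonempty-length (_ ∷ _) _ = s≤s z≤n

  module WitnessGraph {d} {A : List (ℤVec d)} {I : Subset d} {Q : List (State d)} {T : List (Transition d)}
                      (graph : IsSubreachabilityGraph A I Q T) where

    open IsSubreachabilityGraph graph

    q a : ℕ
    q = length Q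
    a = normA A

    valid : ∀ {t} → t ∈ T → src t ∈ Q × lbl t ∈ A × tgt t ∈ Q × Step I (src t) (lbl t) (tgt t)
    valid t∈T = All.lookup T-valid t∈T

    states-nonempty : 1 ≤ q
    states-nonempty = nonempty-length Q Q-nonempty

    label-bound : ∀ {t} → t ∈ T → ∀ i → ∣ lookup (lbl t) i ∣ ≤ a
    label-bound {t} t∈T i = ℕP.≤-trans (normVec-bound (lbl t) i) (normA-bound A (proj₁ (proj₂ (valid t∈T))))

    labelSum-bound : ∀ {C} → All (_∈ T) C → ∀ i → ∣ labelSum C i ∣ ≤ length C ℕ.* a
    labelSum-bound [] i = z≤n
    labelSum-bound {t ∷ C} (t∈T ∷ C⊆T) i =
      ℕP.≤-trans (ℤP.∣i+j∣≤∣i∣+∣j∣ (lookup (lbl t) i) (labelSum C i)) (ℕP.+-mono-≤ (label-bound t∈T i) (labelSum-bound C⊆T i))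

    step-deterministic : ∀ {x b y y′} → Step I x b y → Step I x b y′ → y ≡ y′
    step-deterministic {x} {b} {y} {y′} y-step y′-step = Pointwise-≡⇒≡ (ext same)
      where
        same : ∀ i → lookup y i ≡ lookup y′ i
        same i with i SubsetP.∈? I
        ... | yes i∈I = trans (proj₁ (y-step i) i∈I) (sym (proj₁ (y′-step i) i∈I))
        ... | no i∉I with proj₂ (y-step i) i∉I | proj₂ (y′-step i) i∉I
        ... | m , n , xᵢ≡m , yᵢ≡n , n≡ | m′ , n′ , xᵢ≡m′ , y′ᵢ≡n′ , n′≡ =
          trans yᵢ≡n (trans (cong just (ℤP.+-injective (trans n≡ (trans (cong (λ k → + k + lookup b i) m≡m′) (sym n′≡))))) (sym y′ᵢ≡n′))
          where
            m≡m′ : m ≡ m′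
            m≡m′ = MaybeP.just-injective (trans (sym xᵢ≡m) xᵢ≡m′)

    -- A transition is determined by its source and its label, which lies in [-a, a] ^ d.
    transitions-bound : length T ≤ q ℕ.* suc (2 ℕ.* a) ^ d
    transitions-bound = begin
      length T                                    ≤⟨ length-≤-of-injective signature T candidates T-unique signature∈ injective ⟩
      length candidates                           ≡⟨ length-cartesianProductWith _,_ Q labels ⟩
      q ℕ.* length labels                         ≤⟨ ℕP.*-monoʳ-≤ q (length-box-≤ (Subset.⊤ {d}) (2 ℕ.* a) (λ _ → 2 ℕ.* a) full) ⟩
      q ℕ.* suc (2 ℕ.* a) ^ Subset.∣ Subset.⊤ {d} ∣ ≡⟨ cong (λ k → q ℕ.* suc (2 ℕ.* a) ^ k) (SubsetP.∣⊤∣≡n d) ⟩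
      q ℕ.* suc (2 ℕ.* a) ^ d                     ∎
      where
        open ℕP.≤-Reasoning
        labels : List (Vec ℕ d)
        labels = box d (λ _ → 2 ℕ.* a)
        candidates : List (State d × Vec ℕ d)
        candidates = List.cartesianProduct Q labels
        signature : Transition d → State d × Vec ℕ d
        signature t = src t , Vec.map (encode a) (lbl t)
        full : ∀ i → 2 ℕ.* a ≤ Subsets.mask Subset.⊤ (2 ℕ.* a) i
        full i = ℕP.≤-reflexive (sym (cong (λ b → if b then 2 ℕ.* a else 0) (VecP.lookup-replicate i Subset.inside)))
          where open import Data.Bool using (if_then_else_)
        signature∈ : All (λ t → signature t ∈ candidates) T
        signature∈ = All.tabulate λ {t} t∈T → ∈P.∈-cartesianProduct⁺ (proj₁ (valid t∈T))
          (∈-box⁺ d _ (Vec.map (encode a) (lbl t)) λ i →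
            subst (_≤ 2 ℕ.* a) (sym (VecP.lookup-map i (encode a) (lbl t))) (encode-≤ a (lookup (lbl t) i) (label-bound t∈T i)))
        injective : ∀ {t t′} → t ∈ T → t′ ∈ T → signature t ≡ signature t′ → t ≡ t′
        injective {x , b , y} {x′ , b′ , y′} t∈T t′∈T same with ProductP.,-injective same
        ... | refl , same-code with Pointwise-≡⇒≡ {xs = b} {ys = b′} (ext λ i → encode-injective a (lookup b i) (lookup b′ i) (label-bound t∈T i) (label-bound t′∈T i)
                                    (trans (sym (VecP.lookup-map i (encode a) b)) (trans (cong (λ v → lookup v i) same-code) (VecP.lookup-map i (encode a) b′))))
        ... | refl = cong (λ z → x , b , z) (step-deterministic {x} {b} {y} {y′} (proj₂ (proj₂ (proj₂ (valid t∈T)))) (proj₂ (proj₂ (proj₂ (valid t′∈T)))))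

    -- Coordinates outside I are tracked exactly along walks, so closed walks do not move them.
    unstarred-along-walk : ∀ i → i Subset.∉ I → ∀ {x C y} → Walk x C y → All (_∈ T) C → ∀ m → lookup x i ≡ just m →
      Σ ℕ λ n → lookup y i ≡ just n × + n ≡ + m + labelSum C i
    unstarred-along-walk i i∉I [] [] m xᵢ≡m = m , xᵢ≡m , sym (ℤP.+-identityʳ (+ m))
    unstarred-along-walk i i∉I (step {t = t} {ts = C} refl walk) (t∈T ∷ C⊆T) m xᵢ≡m
      with proj₂ (proj₂ (proj₂ (proj₂ (valid t∈T))) i) i∉I
    ... | m′ , n′ , srcᵢ≡m′ , tgtᵢ≡n′ , n′≡ with unstarred-along-walk i i∉I walk C⊆T n′ tgtᵢ≡n′
    ... | n , yᵢ≡n , n≡ = n , yᵢ≡n , (begin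
      + n                                       ≡⟨ n≡ ⟩
      + n′ + labelSum C i                       ≡⟨ cong (_+ labelSum C i) n′≡ ⟩
      + m′ + lookup (lbl t) i + labelSum C i    ≡⟨ cong (λ k → + k + lookup (lbl t) i + labelSum C i) (MaybeP.just-injective (trans (sym srcᵢ≡m′) xᵢ≡m)) ⟩
      + m + lookup (lbl t) i + labelSum C i     ≡⟨ ℤP.+-assoc (+ m) (lookup (lbl t) i) (labelSum C i) ⟩
      + m + labelSum (t ∷ C) i                  ∎)
      where open ≡-Reasoning

    closed-walk-unstarred : ∀ i → i Subset.∉ I → ∀ {C} → Closed C → All (_∈ T) C → labelSum C i ≡ 0ℤ
    closed-walk-unstarred i i∉I {[]} _ _ = refl
    closed-walk-unstarred i i∉I {t ∷ C} (s , walk@(step refl _)) C⊆T@(t∈T ∷ _) with lookup s i in sᵢ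
    ... | nothing = contradiction (proj₁ (All.lookup Q-in-NI (proj₁ (valid t∈T)) i) sᵢ) i∉I
    ... | just m with unstarred-along-walk i i∉I walk C⊆T m sᵢ
    ... | n , sᵢ≡n , n≡ with trans (sym sᵢ) sᵢ≡n
    ... | refl = ∙-cancelˡ (+ m) (labelSum (t ∷ C) i) 0ℤ (trans (sym n≡) (sym (ℤP.+-identityʳ (+ m))))

    -- If every coordinate is starred, ℕ_I^d has a single element.
    all-starred : (∀ i → i Subset.∈ I) → q ≤ 1
    all-starred starred = length-≤-of-injective (λ _ → ⋆⋯⋆) Q (⋆⋯⋆ ∷ [])
      Q-unique (All.tabulate (λ _ → here refl)) (λ x∈Q y∈Q _ → trans (starred-state x∈Q) (sym (starred-state y∈Q)))
      where
        ⋆⋯⋆ : State d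
        ⋆⋯⋆ = Vec.replicate d nothing
        starred-state : ∀ {x} → x ∈ Q → x ≡ ⋆⋯⋆
        starred-state x∈Q = Pointwise-≡⇒≡ (ext λ i → trans (proj₂ (All.lookup Q-in-NI x∈Q i) (starred i)) (sym (VecP.lookup-replicate i nothing)))

    labels-vanish : a ≡ 0 → ∀ {C} → Closed C → All (_∈ T) C → ∀ i → labelSum C i ≡ 0ℤ
    labels-vanish a≡0 {C} _ C⊆T i =
      ℤP.∣i∣≡0⇒i≡0 (ℕP.n≤0⇒n≡0 (ℕP.≤-trans (labelSum-bound C⊆T i) (ℕP.≤-reflexive (trans (cong (length C ℕ.*_) a≡0) (ℕP.*-zeroʳ (length C))))))

    KernelSolver : ℕ → Set
    KernelSolver Z = ∀ (Cs : List (List (Transition d))) → All Closed Cs → All (All (_∈ T)) Cs → All (λ C → length C ≤ q) Cs →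
      ∀ j₁ → InKernel (cycle-matrix Cs) (λ _ → + 1) → BoundedKernelVector (cycle-matrix Cs) j₁ Z

    cycle-matrix-bound : ∀ Cs → All (All (_∈ T)) Cs → All (λ C → length C ≤ q) Cs → ∀ j i → ∣ cycle-matrix Cs j i ∣ ≤ q ℕ.* a
    cycle-matrix-bound Cs Cs⊆T short j i =
      ℕP.≤-trans (labelSum-bound (All.lookup Cs⊆T (∈P.∈-lookup j)) i) (ℕP.*-monoˡ-≤ a (All.lookup short (∈P.∈-lookup j)))

    trivial-solver : (∀ {C} → Closed C → All (_∈ T) C → ∀ i → labelSum C i ≡ 0ℤ) → KernelSolver 1
    trivial-solver vanish Cs closed Cs⊆T _ j₁ _ =
      trivial-kernel-vector (cycle-matrix Cs) j₁ (vanish (All.lookup closed (∈P.∈-lookup j₁)) (All.lookup Cs⊆T (∈P.∈-lookup j₁)))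

    general-solver : KernelSolver (kernel-bound d (q ℕ.* a))
    general-solver Cs _ Cs⊆T short j₁ ones =
      bounded-kernel-vector (cycle-matrix Cs) (q ℕ.* a) (cycle-matrix-bound Cs Cs⊆T short) j₁ (λ _ → 1) ℕP.≤-refl ones

    -- Reversibility closes a zero-displacement walk through each transition t; its short cycles,
    -- weighted by a kernel vector of their displacements, carry a flow through t.
    bounded-flow : Reversible T → ∀ Z → KernelSolver Z → Σ (Transition d → ℕ) λ μ →
      IsKirchhoff Q T μ × IsTotal T μ × displacement T μ ≡ zeroVec d × NormBounded T μ (length T ℕ.* (Z ℕ.* q))
    bounded-flow reversible Z solve = combine-flows Q T (Z ℕ.* q) flow-through
      where
        flow-through : ∀ {t} → t ∈ T → FlowThrough Q T t (Z ℕ.* q)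
        flow-through t∈T with closed-walk-through T reversible t∈T
        ... | W , walk , W⊆T , t∈W , W-zero with decompose-closed Q walk (λ e∈W → proj₁ (proj₂ (proj₂ (valid (All.lookup W⊆T e∈W)))))
        ... | decomposition = flow-from-cycles Q T T-unique q Z cycles cycles-closed Cs⊆T cycles-short j₁ (lookup-index (covers t∈W))
                                (solve cycles cycles-closed Cs⊆T cycles-short j₁ ones-in-kernel)
          where
            open CycleDecomposition decomposition
            Cs⊆T : All (All (_∈ T)) cycles
            Cs⊆T = All.map (λ C⊆W → All.tabulate (λ e∈C → All.lookup W⊆T (C⊆W e∈C))) cycles⊆W
            j₁ : Fin (length cycles)
            j₁ = index (covers t∈W)
            ones-in-kernel : InKernel (cycle-matrix cycles) (λ _ → + 1)
            ones-in-kernel i = begin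
              comb (cycle-matrix cycles) (λ _ → + 1) i        ≡⟨ ∑-cong (λ j → ℤP.*-identityˡ (cycle-matrix cycles j i)) ⟩
              ∑ (λ j → labelSum (List.lookup cycles j) i)      ≡⟨ ∑-lookup (λ C → labelSum C i) cycles ⟩
              sumℤ (List.map (λ C → labelSum C i) cycles)      ≡⟨ labelSum-split i ⟨
              labelSum W i                                     ≡⟨ W-zero i ⟩
              0ℤ                                               ∎
              where open ≡-Reasoning

    bounded-flow-within : Reversible T → ∀ Z → KernelSolver Z → ∀ {B} → q ℕ.* suc (2 ℕ.* a) ^ d ℕ.* (Z ℕ.* q) ≤ B →
      Σ (Transition d → ℕ) λ μ → IsKirchhoff Q T μ × IsTotal T μ × displacement T μ ≡ zeroVec d × NormBounded T μ B
    bounded-flow-within reversible Z solve within =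
      let μ , kirchhoff , total , balanced , bounded = bounded-flow reversible Z solve in
      μ , kirchhoff , total , balanced , λ t t∈T → ℕP.≤-trans (bounded t t∈T) (ℕP.≤-trans (ℕP.*-monoˡ-≤ (Z ℕ.* q) transitions-bound) within)

open import Defs
open import Data.Nat using (ℕ; zero; suc; _*_; _^_; _+_; z≤n; s≤s; _≟_)
import Data.Nat.Properties as ℕP
open import Data.List using (List; length)
open import Data.Fin using (zero)
open import Data.Fin.Subset using (Subset; inside; outside)
open import Data.Vec using ([]; _∷_; here)
open import Data.Product using (Σ; _×_; _,_)
open import Data.Sum using (inj₁; inj₂)
open import Relation.Nullary using (yes; no)
open import Relation.Binary.PropositionalEquality using (_≡_)
open KernelVectors using (one-dimensional)
open Flows using (cycle-matrix)
open Bounds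
open WitnessGraphs

theorem7p3 : (d : ℕ) (A : List (ℤVec d)) (I : Subset d)
    (Q : List (State d)) (T : List (Transition d)) →
    IsWitnessGraph A I Q T → Reversible T →
    Σ (Transition d → ℕ) λ μ →
      IsKirchhoff Q T μ × IsTotal T μ × displacement T μ ≡ zeroVec d ×
      NormBounded T μ ((length Q * (1 + 2 * normA A)) ^ (d * (d + 1)))
theorem7p3 zero A I Q T (graph , _) reversible =
  bounded-flow-within reversible 1 (trivial-solver λ _ _ ())
    (flow-bound-trivial q (1 + 2 * a) 0 states-nonempty (s≤s z≤n) (inj₂ (all-starred λ ())))
  where open WitnessGraph graph
theorem7p3 (suc zero) A (outside ∷ []) Q T (graph , _) reversible =
  bounded-flow-within reversible 1 (trivial-solver λ closed C⊆T → λ { zero → closed-walk-unstarred zero (λ ()) closed C⊆T })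
    (flow-bound-trivial q (1 + 2 * a) 1 states-nonempty (s≤s z≤n) (inj₁ (s≤s z≤n)))
  where open WitnessGraph graph
theorem7p3 (suc zero) A (inside ∷ []) Q T (graph , _) reversible =
  bounded-flow-within reversible (1 + 2 * (q * a))
    (λ Cs _ Cs⊆T short j₁ ones → one-dimensional (cycle-matrix Cs) (q * a) (cycle-matrix-bound Cs Cs⊆T short) j₁ (λ _ → 1) ℕP.≤-refl ones)
    (flow-bound-one-dimensional q a (ℕP.≤-antisym (all-starred λ { zero → here }) states-nonempty))
  where open WitnessGraph graph
theorem7p3 (suc (suc d)) A I Q T (graph , _) reversible with normA A ≟ 0
... | yes a≡0 = bounded-flow-within reversible 1 (trivial-solver (labels-vanish a≡0))
                  (flow-bound-trivial q (1 + 2 * a) (2 + d) states-nonempty (s≤s z≤n) (inj₁ (s≤s z≤n)))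
  where open WitnessGraph graph
... | no a≢0 = bounded-flow-within reversible _ general-solver
                 (flow-bound-general (2 + d) q a (s≤s (s≤s z≤n)) states-nonempty (ℕP.n≢0⇒n>0 a≢0))
  where open WitnessGraph graph
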